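{- Let $d=2m$ with $m\ge3$ odd and $3\nmid d$, and let $f=a_1x_1^d+\dots+a_sx_s^d$ be an additive form over $K=\mathbb{Q}_2(\sqrt5)$. Suppose there is a level $k\in\mathbb Z/d\mathbb Z$ such that levels $k$, $k+1$, $k+2$ contain at least $2$, at least $1$, and at least $1$ variables, respectively. Then $f$ has a nontrivial zero in $K$.
   Context: $K=\mathbb{Q}_2(\sqrt5)$ has ring of integers $\mathcal O=\mathbb Z_2[\alpha]$, $\alpha=(1+\sqrt5)/2$, and $2$ is a uniformizer. A nontrivial zero is $(x_1,\dots,x_s)\in K^s\setminus\{0\}$ with $f=0$. For a variable $x_i$ with $a_i\neq0$ write $a_i=2^{v_i}u_i$ with $v_i\in\mathbb Z$, $u_i\in\mathcal O^\times$; the level of $x_i$ is $v_i\bmod d\in\mathbb Z/d\mathbb Z$. Only variables with nonzero coefficient are assigned levels and counted. -}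

module Defs where

-- Model of K = Q_2(√5):
--   ℤα      : ℤ[α], α = (1+√5)/2, α² = α + 1 (pairs re + im·α)
--   O       : 2-adic completion Z_2[α] = lim ℤ[α]/2^n, as coherent sequences
--             x : ℕ → ℤ[α] with x(n+1) ≡ x(n) mod 2^n, equality mod 2^n at every n
--   K       : O[1/2] = Q_2(√5) (2 is a uniformizer), pairs (k , x) meaning x / 2^k

open import Data.Nat as ℕ using (ℕ; zero; suc)
open import Data.Integer as ℤ using (ℤ; +_; -[1+_]; _+_; _*_; _-_; -_)
open import Data.Integer.Divisibility.Signed using (_∣_; ∣m∣n⇒∣m+n; ∣m∣n⇒∣m-n; ∣n⇒∣m*n; ∣m⇒∣m*n)
import Data.Integer.Divisibility.Signed as DS
import Data.Integer.Properties as ℤP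
open import Data.Integer.Solver using (module +-*-Solver)
open import Data.Product using (Σ; _×_; _,_; proj₁; proj₂)
import Data.Fin as Fin
open import Data.Fin using (Fin)
open import Relation.Binary.PropositionalEquality using (_≡_; refl; subst; sym)

record ℤα : Set where
  constructor mkα
  field
    re : ℤ
    im : ℤ
open ℤα public

_+α_ : ℤα → ℤα → ℤα
mkα a b +α mkα c d = mkα (a + c) (b + d)

_-α_ : ℤα → ℤα → ℤα
mkα a b -α mkα c d = mkα (a - c) (b - d)

-- (a + bα)(c + dα) = (ac + bd) + (ad + bc + bd)α   since α² = α + 1
_*α_ : ℤα → ℤα → ℤα
mkα a b *α mkα c d = mkα (a * c + b * d) (a * d + b * c + b * d)

pow2 : ℕ → ℤ
pow2 n = + (2 ℕ.^ n)

Dvα : ℕ → ℤα → Set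
Dvα n z = (pow2 n ∣ re z) × (pow2 n ∣ im z)

private
  open +-*-Solver

  diff-add : ∀ a a' c c' → (a' + c') - (a + c) ≡ (a' - a) + (c' - c)
  diff-add = solve 4 (λ a a' c c' → (a' :+ c') :- (a :+ c) := (a' :- a) :+ (c' :- c)) refl

  diff-mul : ∀ a a' c c' → a' * c' - a * c ≡ a' * (c' - c) + (a' - a) * c
  diff-mul = solve 4 (λ a a' c c' → a' :* c' :- a :* c := a' :* (c' :- c) :+ (a' :- a) :* c) refl

  diff-self : ∀ a → a - a ≡ + 0
  diff-self = solve 1 (λ a → a :- a := con (+ 0)) refl

  dv-add : ∀ {k} a a' c c' → k ∣ (a' - a) → k ∣ (c' - c) → k ∣ ((a' + c') - (a + c))
  dv-add a a' c c' p q = subst (_ ∣_) (sym (diff-add a a' c c')) (∣m∣n⇒∣m+n p q)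

  dv-mul : ∀ {k} a a' c c' → k ∣ (a' - a) → k ∣ (c' - c) → k ∣ (a' * c' - a * c)
  dv-mul a a' c c' p q =
    subst (_ ∣_) (sym (diff-mul a a' c c')) (∣m∣n⇒∣m+n (∣n⇒∣m*n a' q) (∣m⇒∣m*n c p))

  dv-self : ∀ {k} a → k ∣ (a - a)
  dv-self {k} a = subst (k ∣_) (sym (diff-self a)) (DS.divides (+ 0) (sym (ℤP.*-zeroˡ k)))

  dvα-add : ∀ n x x' y y' → Dvα n (x' -α x) → Dvα n (y' -α y) → Dvα n ((x' +α y') -α (x +α y))
  dvα-add n (mkα a b) (mkα a' b') (mkα c d) (mkα c' d') (p₁ , p₂) (q₁ , q₂) =
    dv-add a a' c c' p₁ q₁ , dv-add b b' d d' p₂ q₂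

  dvα-mul : ∀ n x x' y y' → Dvα n (x' -α x) → Dvα n (y' -α y) → Dvα n ((x' *α y') -α (x *α y))
  dvα-mul n (mkα a b) (mkα a' b') (mkα c d) (mkα c' d') (p₁ , p₂) (q₁ , q₂) =
    dv-add (a * c) (a' * c') (b * d) (b' * d')
      (dv-mul a a' c c' p₁ q₁) (dv-mul b b' d d' p₂ q₂)
    , dv-add (a * d + b * c) (a' * d' + b' * c') (b * d) (b' * d')
      (dv-add (a * d) (a' * d') (b * c) (b' * c')
        (dv-mul a a' d d' p₁ q₂) (dv-mul b b' c c' p₂ q₁))
      (dv-mul b b' d d' p₂ q₂)

  dvα-self : ∀ n x → Dvα n (x -α x)
  dvα-self n (mkα a b) = dv-self a , dv-self b

record O : Set where
  constructor mkO
  field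
    seq : ℕ → ℤα
    coh : ∀ n → Dvα n (seq (suc n) -α seq n)
open O public

infix 4 _≈O_
_≈O_ : O → O → Set
x ≈O y = ∀ n → Dvα n (seq x n -α seq y n)

constO : ℤα → O
constO c = mkO (λ _ → c) (λ n → dvα-self n c)

infixl 6 _+O_ _+K_ _+α_ _-α_
infixl 7 _*O_ _*K_ _*α_
infixr 8 _^K_

_+O_ : O → O → O
x +O y = mkO (λ n → seq x n +α seq y n)
             (λ n → dvα-add n (seq x n) (seq x (suc n)) (seq y n) (seq y (suc n)) (coh x n) (coh y n))

_*O_ : O → O → O
x *O y = mkO (λ n → seq x n *α seq y n)
             (λ n → dvα-mul n (seq x n) (seq x (suc n)) (seq y n) (seq y (suc n)) (coh x n) (coh y n))

0O 1O : O
0O = constO (mkα (+ 0) (+ 0))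
1O = constO (mkα (+ 1) (+ 0))

twoO : ℕ → O
twoO n = constO (mkα (pow2 n) (+ 0))

IsUnitO : O → Set
IsUnitO u = Σ O λ w → u *O w ≈O 1O

-- K = O[1/2] = Q_2(√5); mkK k x stands for x / 2^k

record K : Set where
  constructor mkK
  field
    den : ℕ
    num : O
open K public

infix 4 _≈K_
_≈K_ : K → K → Set
mkK k x ≈K mkK l y = twoO l *O x ≈O twoO k *O y

_+K_ : K → K → K
mkK k x +K mkK l y = mkK (k ℕ.+ l) (twoO l *O x +O twoO k *O y)

_*K_ : K → K → K
mkK k x *K mkK l y = mkK (k ℕ.+ l) (x *O y)

0K 1K : K
0K = mkK 0 0O
1K = mkK 0 1O

ιK : O → K
ιK x = mkK 0 x

_^K_ : K → ℕ → K
x ^K zero  = 1K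
x ^K suc n = x *K (x ^K n)

twoPowK : ℤ → K
twoPowK (+ n)      = mkK 0 (twoO n)
twoPowK -[1+ n ]   = mkK (suc n) 1O

sumK : (s : ℕ) → (Fin s → K) → K
sumK zero    f = 0K
sumK (suc s) f = f Fin.zero +K sumK s (λ i → f (Fin.suc i))

-- a = 2^v · u with u ∈ O^×  (this forces a ≠ 0)
HasValuation : K → ℤ → Set
HasValuation a v = Σ O λ u → IsUnitO u × (a ≈K (twoPowK v *K ιK u))

LevelIs : ℕ → K → ℤ → Set
LevelIs d a k = Σ ℤ λ v → HasValuation a v × ((+ d) ∣ (v - k))

-- Write the four chosen coefficients as 2^(k + δ + c d) u with units u, offsets δ = 0, 0, 1, 2 and c ∈ ℤ.
-- Scaling each variable by a suitable power of 2 turns the form, up to a common factor 2^G, into the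
-- normalised form u₀y₀ᵈ + u₁y₁ᵈ + 2u₂y₂ᵈ + 4u₃y₃ᵈ. As 3 ∤ d, the d-th power map is a bijection of the
-- residue field ℤ[α]/2 = 𝔽₄, so the 2-adic digits of the normalised form can be cleared one at a time,
-- giving a zero modulo 8 with y₀ = 1. Since d = 2m with m odd, the derivative d u₀ y₀^(d-1) has valuation
-- exactly 1, and Hensel's lemma lifts y₀ to a 2-adic zero.

module Submission where

open import Defs
open import Data.Nat as ℕ using (ℕ; zero; suc; _≤_; _<_; _*_; s≤s; z≤n; NonZero)
import Data.Nat.Properties as ℕP
import Data.Nat.Divisibility as ℕD
open import Data.Nat.Divisibility using (_∣_)
open import Data.Integer as ℤ using (ℤ; +_; -[1+_]) renaming (_+_ to _+ℤ_)
import Data.Integer.Properties as ℤP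
import Data.Integer.Divisibility.Signed as DS
open import Data.Integer.DivMod using (_%ℕ_; _/ℕ_; n%ℕd<d; a≡a%ℕn+[a/ℕn]*n)
open import Data.Fin as Fin using (Fin)
open import Data.Fin.Patterns using (0F; 1F; 2F; 3F)
open import Data.Fin.Properties using (any?)
open import Data.Product using (Σ; _×_; _,_; proj₁; proj₂)
open import Data.Sum using (_⊎_; inj₁; inj₂)
open import Data.Empty using (⊥-elim)
open import Data.Maybe using (Maybe; just; nothing)
open import Relation.Nullary using (¬_; yes; no)
open import Relation.Binary.Definitions using (tri<; tri≈; tri>)
open import Relation.Binary.PropositionalEquality
open import Relation.Binary.Bundles using (Setoid)
import Relation.Binary.Reasoning.Setoid as SetoidReasoning
open import Algebra.Bundles using (CommutativeRing)
open import Algebra.Structures using (IsCommutativeRing)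
import Algebra.Solver.Ring
import Algebra.Solver.Ring.AlmostCommutativeRing as ACR
open import Data.Integer.Solver using () renaming (module +-*-Solver to ℤ-Solver)
open import Data.Integer.Tactic.RingSolver using (solve-∀)
open import Data.Nat.Tactic.RingSolver using () renaming (solve-∀ to ℕ-solve-∀)
open import Data.Nat.DivMod using (_%_; _/_; m%n<n; m≡m%n+[m/n]*n)

0α 1α : ℤα
0α = mkα (+ 0) (+ 0)
1α = mkα (+ 1) (+ 0)

fromℤ : ℤ → ℤα
fromℤ a = mkα a (+ 0)

mkα-cong : ∀ {a b c d} → a ≡ c → b ≡ d → mkα a b ≡ mkα c d
mkα-cong refl refl = refl

infixl 6 _⊕_ _⊖_
infixl 7 _⊗_
infix 8 ⊝_

-- Opaque copies of the operations of Defs, so that the ring solver treats them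
-- as uninterpreted symbols instead of unfolding them into integer components.
opaque
  _⊕_ _⊗_ : ℤα → ℤα → ℤα
  _⊕_ = _+α_
  _⊗_ = _*α_

  ⊝_ : ℤα → ℤα
  ⊝ mkα a b = mkα (ℤ.- a) (ℤ.- b)

  ⊕-def : ∀ x y → x ⊕ y ≡ x +α y
  ⊕-def x y = refl

  ⊗-def : ∀ x y → x ⊗ y ≡ x *α y
  ⊗-def x y = refl

  ⊖-def : ∀ x y → x ⊕ ⊝ y ≡ x -α y
  ⊖-def (mkα a b) (mkα c d) = refl

  ⊕-assoc : ∀ x y z → (x ⊕ y) ⊕ z ≡ x ⊕ (y ⊕ z)
  ⊕-assoc (mkα a b) (mkα c d) (mkα e f) = mkα-cong (ℤP.+-assoc a c e) (ℤP.+-assoc b d f)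

  ⊕-comm : ∀ x y → x ⊕ y ≡ y ⊕ x
  ⊕-comm (mkα a b) (mkα c d) = mkα-cong (ℤP.+-comm a c) (ℤP.+-comm b d)

  ⊕-identityˡ : ∀ x → 0α ⊕ x ≡ x
  ⊕-identityˡ (mkα a b) = mkα-cong (ℤP.+-identityˡ a) (ℤP.+-identityˡ b)

  ⊕-identityʳ : ∀ x → x ⊕ 0α ≡ x
  ⊕-identityʳ (mkα a b) = mkα-cong (ℤP.+-identityʳ a) (ℤP.+-identityʳ b)

  ⊝-inverseˡ : ∀ x → ⊝ x ⊕ x ≡ 0α
  ⊝-inverseˡ (mkα a b) = mkα-cong (ℤP.+-inverseˡ a) (ℤP.+-inverseˡ b)

  ⊝-inverseʳ : ∀ x → x ⊕ ⊝ x ≡ 0α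
  ⊝-inverseʳ (mkα a b) = mkα-cong (ℤP.+-inverseʳ a) (ℤP.+-inverseʳ b)

  ⊗-assoc : ∀ x y z → (x ⊗ y) ⊗ z ≡ x ⊗ (y ⊗ z)
  ⊗-assoc (mkα a b) (mkα c d) (mkα e f) = mkα-cong
    (solve 6 (λ a b c d e f → (a :* c :+ b :* d) :* e :+ (a :* d :+ b :* c :+ b :* d) :* f
                 := a :* (c :* e :+ d :* f) :+ b :* (c :* f :+ d :* e :+ d :* f)) refl a b c d e f)
    (solve 6 (λ a b c d e f → (a :* c :+ b :* d) :* f :+ (a :* d :+ b :* c :+ b :* d) :* e
                               :+ (a :* d :+ b :* c :+ b :* d) :* f
                 := a :* (c :* f :+ d :* e :+ d :* f) :+ b :* (c :* e :+ d :* f)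
                    :+ b :* (c :* f :+ d :* e :+ d :* f)) refl a b c d e f)
    where open ℤ-Solver

  ⊗-comm : ∀ x y → x ⊗ y ≡ y ⊗ x
  ⊗-comm (mkα a b) (mkα c d) = mkα-cong
    (solve 4 (λ a b c d → a :* c :+ b :* d := c :* a :+ d :* b) refl a b c d)
    (solve 4 (λ a b c d → a :* d :+ b :* c :+ b :* d := c :* b :+ d :* a :+ d :* b) refl a b c d)
    where open ℤ-Solver

  ⊗-identityˡ : ∀ x → 1α ⊗ x ≡ x
  ⊗-identityˡ (mkα a b) = mkα-cong
    (solve 2 (λ a b → con (+ 1) :* a :+ con (+ 0) :* b := a) refl a b)
    (solve 2 (λ a b → con (+ 1) :* b :+ con (+ 0) :* a :+ con (+ 0) :* b := b) refl a b)
    where open ℤ-Solver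

  ⊗-distribˡ-⊕ : ∀ x y z → x ⊗ (y ⊕ z) ≡ x ⊗ y ⊕ x ⊗ z
  ⊗-distribˡ-⊕ (mkα a b) (mkα c d) (mkα e f) = mkα-cong
    (solve 6 (λ a b c d e f → a :* (c :+ e) :+ b :* (d :+ f)
                 := (a :* c :+ b :* d) :+ (a :* e :+ b :* f)) refl a b c d e f)
    (solve 6 (λ a b c d e f → a :* (d :+ f) :+ b :* (c :+ e) :+ b :* (d :+ f)
                 := (a :* d :+ b :* c :+ b :* d) :+ (a :* f :+ b :* e :+ b :* f)) refl a b c d e f)
    where open ℤ-Solver

  fromℤ-+ : ∀ a b → fromℤ (a +ℤ b) ≡ fromℤ a ⊕ fromℤ b
  fromℤ-+ a b = refl

  fromℤ-* : ∀ a b → fromℤ (a ℤ.* b) ≡ fromℤ a ⊗ fromℤ b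
  fromℤ-* a b = mkα-cong (sym (ℤP.+-identityʳ _))
    (sym (trans (cong₂ _+ℤ_ (cong₂ _+ℤ_ (ℤP.*-zeroʳ a) (ℤP.*-zeroˡ b)) (ℤP.*-zeroˡ (+ 0))) refl))

  fromℤ-neg : ∀ a → fromℤ (ℤ.- a) ≡ ⊝ fromℤ a
  fromℤ-neg a = refl

  ℤα-isCommutativeRing : IsCommutativeRing _≡_ _⊕_ _⊗_ ⊝_ 0α 1α
  ℤα-isCommutativeRing = record
    { isRing = record
      { +-isAbelianGroup = record
        { isGroup = record
          { isMonoid = record
            { isSemigroup = record
              { isMagma = record { isEquivalence = isEquivalence ; ∙-cong = cong₂ _⊕_ }
              ; assoc = ⊕-assoc }
            ; identity = ⊕-identityˡ , ⊕-identityʳ }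
          ; inverse = ⊝-inverseˡ , ⊝-inverseʳ
          ; ⁻¹-cong = cong ⊝_ }
        ; comm = ⊕-comm }
      ; *-cong = cong₂ _⊗_
      ; *-assoc = ⊗-assoc
      ; *-identity = ⊗-identityˡ , λ x → trans (⊗-comm x 1α) (⊗-identityˡ x)
      ; distrib = ⊗-distribˡ-⊕
                , λ x y z → trans (⊗-comm (y ⊕ z) x)
                             (trans (⊗-distribˡ-⊕ x y z) (cong₂ _⊕_ (⊗-comm x y) (⊗-comm x z))) }
    ; *-comm = ⊗-comm }

ℤα-commutativeRing : CommutativeRing _ _
ℤα-commutativeRing = record { isCommutativeRing = ℤα-isCommutativeRing }

open CommutativeRing ℤα-commutativeRing
  using () renaming (*-identityʳ to ⊗-identityʳ; zeroˡ to ⊗-zeroˡ; zeroʳ to ⊗-zeroʳ)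

_⊖_ : ℤα → ℤα → ℤα
x ⊖ y = x ⊕ ⊝ y

module ℤα-Solver where
  private
    fromℤ-morphism : ACR._-Raw-AlmostCommutative⟶_ (CommutativeRing.rawRing ℤP.+-*-commutativeRing)
                                                    (ACR.fromCommutativeRing ℤα-commutativeRing)
    fromℤ-morphism = record { ⟦_⟧ = fromℤ ; +-homo = fromℤ-+ ; *-homo = fromℤ-* ; -‿homo = fromℤ-neg
                            ; 0-homo = refl ; 1-homo = refl }

    fromℤ-≟ : ∀ a b → Maybe (fromℤ a ≡ fromℤ b)
    fromℤ-≟ a b with a ℤ.≟ b
    ... | yes refl = just refl
    ... | no _ = nothing

  open Algebra.Solver.Ring (CommutativeRing.rawRing ℤP.+-*-commutativeRing)
    (ACR.fromCommutativeRing ℤα-commutativeRing) fromℤ-morphism fromℤ-≟ public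

open ℤα-Solver using (solve; _:+_; _:*_; _:-_; :-_; con; _:=_)

open import Algebra.Properties.CommutativeSemiring.Exp
  (CommutativeRing.commutativeSemiring ℤα-commutativeRing) using (_^_; ^-homo-*; ^-assocʳ; ^-distrib-*)
open import Algebra.Properties.Semiring.Sum (CommutativeRing.semiring ℤα-commutativeRing)
  using (sum; sum-syntax; ∑-comm; *-distribˡ-sum; sum-cong-≗; sum-replicate-zero)

fromℕ : ℕ → ℤα
fromℕ n = fromℤ (+ n)

two : ℤα
two = fromℕ 2

2^ : ℕ → ℤα
2^ n = fromℤ (pow2 n)

2^-+ : ∀ a b → 2^ (a ℕ.+ b) ≡ 2^ a ⊗ 2^ b
2^-+ a b = trans (cong fromℤ (trans (cong +_ (ℕP.^-distribˡ-+-* 2 a b)) (ℤP.pos-* (2 ℕ.^ a) (2 ℕ.^ b))))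
                 (fromℤ-* _ _)

2^-suc : ∀ n → 2^ (suc n) ≡ two ⊗ 2^ n
2^-suc = 2^-+ 1

2^-^ : ∀ a k → 2^ a ^ k ≡ 2^ (a * k)
2^-^ a zero = cong 2^ (sym (ℕP.*-zeroʳ a))
2^-^ a (suc k) = trans (cong (2^ a ⊗_) (2^-^ a k))
                       (trans (sym (2^-+ a (a * k))) (cong 2^ (sym (ℕP.*-suc a k))))

1^n≡1 : ∀ n → 1α ^ n ≡ 1α
1^n≡1 zero = refl
1^n≡1 (suc n) = trans (⊗-identityˡ _) (1^n≡1 n)

0^n≡0 : ∀ n .{{_ : NonZero n}} → 0α ^ n ≡ 0α
0^n≡0 (suc n) = ⊗-zeroˡ _

infix 4 2^_∣α_ _≈[_]_

record 2^_∣α_ (n : ℕ) (z : ℤα) : Set where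
  constructor divides
  field
    quotient : ℤα
    equality : z ≡ 2^ n ⊗ quotient

∣α-resp-≡ : ∀ {n x y} → x ≡ y → 2^ n ∣α x → 2^ n ∣α y
∣α-resp-≡ {n} = subst (2^ n ∣α_)

2^∣α-multiple : ∀ n q → 2^ n ∣α 2^ n ⊗ q
2^∣α-multiple n q = divides q refl

2^∣α0 : ∀ n → 2^ n ∣α 0α
2^∣α0 n = divides 0α (sym (⊗-zeroʳ (2^ n)))

∣α-+ : ∀ {n x y} → 2^ n ∣α x → 2^ n ∣α y → 2^ n ∣α x ⊕ y
∣α-+ {n} (divides p refl) (divides q refl) = divides (p ⊕ q) (sym (⊗-distribˡ-⊕ (2^ n) p q))

∣α-⊝ : ∀ {n x} → 2^ n ∣α x → 2^ n ∣α ⊝ x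
∣α-⊝ {n} (divides p refl) =
  divides (⊝ p) (solve 2 (λ t p → :- (t :* p) := t :* (:- p)) refl (2^ n) p)

∣α-*ʳ : ∀ {n x} y → 2^ n ∣α x → 2^ n ∣α x ⊗ y
∣α-*ʳ {n} y (divides p refl) = divides (p ⊗ y) (⊗-assoc (2^ n) p y)

∣α-*ˡ : ∀ {n} x {y} → 2^ n ∣α y → 2^ n ∣α x ⊗ y
∣α-*ˡ x {y} d = ∣α-resp-≡ (⊗-comm y x) (∣α-*ʳ x d)

∣α-weaken : ∀ {m n z} → n ≤ m → 2^ m ∣α z → 2^ n ∣α z
∣α-weaken {m} {n} n≤m (divides p refl) = divides (2^ (m ℕ.∸ n) ⊗ p) (begin
  2^ m ⊗ p                          ≡⟨ cong (λ e → 2^ e ⊗ p) (sym (ℕP.m+[n∸m]≡n n≤m)) ⟩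
  2^ (n ℕ.+ (m ℕ.∸ n)) ⊗ p          ≡⟨ cong (_⊗ p) (2^-+ n (m ℕ.∸ n)) ⟩
  2^ n ⊗ 2^ (m ℕ.∸ n) ⊗ p           ≡⟨ ⊗-assoc _ _ _ ⟩
  2^ n ⊗ (2^ (m ℕ.∸ n) ⊗ p)         ∎)
  where open ≡-Reasoning

∣α-scale : ∀ {a} b {z} → 2^ a ∣α z → 2^ (b ℕ.+ a) ∣α 2^ b ⊗ z
∣α-scale {a} b (divides p refl) =
  divides p (trans (sym (⊗-assoc (2^ b) (2^ a) p)) (cong (_⊗ p) (sym (2^-+ b a))))

record _≈[_]_ (x : ℤα) (n : ℕ) (y : ℤα) : Set where
  constructor mod-2^
  field
    difference : 2^ n ∣α x ⊖ y

≈-refl : ∀ {n x} → x ≈[ n ] x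
≈-refl {n} {x} = mod-2^ (∣α-resp-≡ (sym (solve 1 (λ x → x :- x := con (+ 0)) refl x)) (2^∣α0 n))

≈-reflexive : ∀ {n x y} → x ≡ y → x ≈[ n ] y
≈-reflexive refl = ≈-refl

≈-sym : ∀ {n x y} → x ≈[ n ] y → y ≈[ n ] x
≈-sym {x = x} {y} (mod-2^ d) =
  mod-2^ (∣α-resp-≡ (solve 2 (λ x y → :- (x :- y) := y :- x) refl x y) (∣α-⊝ d))

≈-trans : ∀ {n x y z} → x ≈[ n ] y → y ≈[ n ] z → x ≈[ n ] z
≈-trans {x = x} {y} {z} (mod-2^ d) (mod-2^ e) =
  mod-2^ (∣α-resp-≡ (solve 3 (λ x y z → (x :- y) :+ (y :- z) := x :- z) refl x y z) (∣α-+ d e))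

≈-setoid : ℕ → Setoid _ _
≈-setoid n = record
  { Carrier = ℤα
  ; _≈_ = _≈[ n ]_
  ; isEquivalence = record { refl = ≈-refl ; sym = ≈-sym ; trans = ≈-trans } }

module ≈-Reasoning (n : ℕ) = SetoidReasoning (≈-setoid n)

≈-+ : ∀ {n x x' y y'} → x ≈[ n ] x' → y ≈[ n ] y' → x ⊕ y ≈[ n ] x' ⊕ y'
≈-+ {x = x} {x'} {y} {y'} (mod-2^ d) (mod-2^ e) = mod-2^ (∣α-resp-≡
  (solve 4 (λ x x' y y' → (x :- x') :+ (y :- y') := (x :+ y) :- (x' :+ y')) refl x x' y y')
  (∣α-+ d e))

≈-* : ∀ {n x x' y y'} → x ≈[ n ] x' → y ≈[ n ] y' → x ⊗ y ≈[ n ] x' ⊗ y'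
≈-* {x = x} {x'} {y} {y'} (mod-2^ d) (mod-2^ e) = mod-2^ (∣α-resp-≡
  (solve 4 (λ x x' y y' → (x :- x') :* y :+ x' :* (y :- y') := x :* y :- x' :* y') refl x x' y y')
  (∣α-+ (∣α-*ʳ y d) (∣α-*ˡ x' e)))

≈-*ˡ : ∀ {n} c {y y'} → y ≈[ n ] y' → c ⊗ y ≈[ n ] c ⊗ y'
≈-*ˡ c = ≈-* ≈-refl

≈-^ : ∀ {n x y} k → x ≈[ n ] y → x ^ k ≈[ n ] y ^ k
≈-^ zero _ = ≈-refl
≈-^ (suc k) x≈y = ≈-* x≈y (≈-^ k x≈y)

≈-weaken : ∀ {m n x y} → n ≤ m → x ≈[ m ] y → x ≈[ n ] y
≈-weaken n≤m (mod-2^ d) = mod-2^ (∣α-weaken n≤m d)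

∣α⇒≈0 : ∀ {n x} → 2^ n ∣α x → x ≈[ n ] 0α
∣α⇒≈0 {x = x} d = mod-2^ (∣α-resp-≡ (sym (solve 1 (λ x → x :- con (+ 0) := x) refl x)) d)

≈0⇒∣α : ∀ {n x} → x ≈[ n ] 0α → 2^ n ∣α x
≈0⇒∣α {x = x} (mod-2^ d) = ∣α-resp-≡ (solve 1 (λ x → x :- con (+ 0) := x) refl x) d

∣α-resp-≈ : ∀ {n x y} → x ≈[ n ] y → 2^ n ∣α y → 2^ n ∣α x
∣α-resp-≈ {x = x} {y} (mod-2^ d) e =
  ∣α-resp-≡ (solve 2 (λ x y → (x :- y) :+ y := x) refl x y) (∣α-+ d e)

private
  re[2ⁿ⊗q] : ∀ p q₁ q₂ → q₁ ℤ.* p ≡ p ℤ.* q₁ +ℤ + 0 ℤ.* q₂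
  re[2ⁿ⊗q] = solve-∀

  im[2ⁿ⊗q] : ∀ p q₁ q₂ → q₂ ℤ.* p ≡ p ℤ.* q₂ +ℤ + 0 ℤ.* q₁ +ℤ + 0 ℤ.* q₂
  im[2ⁿ⊗q] = solve-∀

Dvα⇒∣α : ∀ {n z} → Dvα n z → 2^ n ∣α z
Dvα⇒∣α {n} {mkα a b} (DS.divides q₁ e₁ , DS.divides q₂ e₂) =
  divides (mkα q₁ q₂) (trans (mkα-cong (trans e₁ (re[2ⁿ⊗q] (pow2 n) q₁ q₂)) (trans e₂ (im[2ⁿ⊗q] (pow2 n) q₁ q₂)))
                             (sym (⊗-def (2^ n) (mkα q₁ q₂))))

∣α⇒Dvα : ∀ {n z} → 2^ n ∣α z → Dvα n z
∣α⇒Dvα {n} (divides (mkα q₁ q₂) refl) rewrite ⊗-def (2^ n) (mkα q₁ q₂) =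
  DS.divides q₁ (sym (re[2ⁿ⊗q] (pow2 n) q₁ q₂)) , DS.divides q₂ (sym (im[2ⁿ⊗q] (pow2 n) q₁ q₂))

Dvα⇒≈ : ∀ {n x y} → Dvα n (x -α y) → x ≈[ n ] y
Dvα⇒≈ {x = x} {y} d = mod-2^ (∣α-resp-≡ (sym (⊖-def x y)) (Dvα⇒∣α d))

≈⇒Dvα : ∀ {n x y} → x ≈[ n ] y → Dvα n (x -α y)
≈⇒Dvα {x = x} {y} (mod-2^ d) = ∣α⇒Dvα (∣α-resp-≡ (⊖-def x y) d)

Coherent : (ℕ → ℤα) → Set
Coherent c = ∀ n → c (suc n) ≈[ n ] c n

seq-coherent : ∀ x → Coherent (seq x)
seq-coherent x n = Dvα⇒≈ (coh x n)

coherent-+ : ∀ {c} → Coherent c → ∀ k n → c (k ℕ.+ n) ≈[ n ] c n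
coherent-+ c-coh zero n = ≈-refl
coherent-+ c-coh (suc k) n =
  ≈-trans (≈-weaken (ℕP.m≤n+m n k) (c-coh (k ℕ.+ n))) (coherent-+ c-coh k n)

module Limit {A : ℕ → Set} (point : ∀ {k} → A k → ℤα)
             (refine : ∀ {k} (a : A k) → Σ (A (suc k)) λ a' → point a' ≈[ k ] point a) where

  iterate : A 0 → ∀ k → A k
  iterate a₀ zero = a₀
  iterate a₀ (suc k) = proj₁ (refine (iterate a₀ k))

  limit : A 0 → O
  limit a₀ = mkO (λ k → point (iterate a₀ k)) (λ k → ≈⇒Dvα (proj₂ (refine (iterate a₀ k))))

inverse-mod-2^ : ∀ u (u-unit : IsUnitO u) n → seq u n ⊗ seq (proj₁ u-unit) n ≈[ n ] 1α
inverse-mod-2^ u (w , uw≈1) n = ≈-trans (≈-reflexive (⊗-def (seq u n) (seq w n))) (Dvα⇒≈ (uw≈1 n))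

∑-≈ : ∀ {n k} {f g : Fin n → ℤα} → (∀ e → f e ≈[ k ] g e) → sum f ≈[ k ] sum g
∑-≈ {zero} _ = ≈-refl
∑-≈ {suc n} f≈g = ≈-+ (f≈g Fin.zero) (∑-≈ (λ e → f≈g (Fin.suc e)))

-- The residue field ℤ[α]/2 ≅ 𝔽₄

private
  parity : ∀ a → Σ ℤ (λ q → a ≡ + 0 +ℤ q ℤ.* + 2) ⊎ Σ ℤ (λ q → a ≡ + 1 +ℤ q ℤ.* + 2)
  parity a with a %ℕ 2 | n%ℕd<d a 2 | a≡a%ℕn+[a/ℕn]*n a 2
  ... | 0 | _ | e = inj₁ (a /ℕ 2 , e)
  ... | 1 | _ | e = inj₂ (a /ℕ 2 , e)
  ... | suc (suc _) | s≤s (s≤s ()) | _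

  reduce-mod-2 : ∀ r s q₁ q₂ → mkα (r +ℤ q₁ ℤ.* + 2) (s +ℤ q₂ ℤ.* + 2) ≈[ 1 ] mkα r s
  reduce-mod-2 r s q₁ q₂ = mod-2^ (divides (mkα q₁ q₂)
    (trans (⊖-def _ _) (trans (mkα-cong (re-eq r q₁ q₂) (im-eq s q₁ q₂)) (sym (⊗-def two (mkα q₁ q₂))))))
    where
    re-eq : ∀ r q₁ q₂ → r +ℤ q₁ ℤ.* + 2 ℤ.- r ≡ + 2 ℤ.* q₁ +ℤ + 0 ℤ.* q₂
    re-eq = solve-∀
    im-eq : ∀ s q₁ q₂ → s +ℤ q₂ ℤ.* + 2 ℤ.- s ≡ + 2 ℤ.* q₂ +ℤ + 0 ℤ.* q₁ +ℤ + 0 ℤ.* q₂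
    im-eq = solve-∀

  opaque
    unfolding _⊗_

    α³≈1 : mkα (+ 0) (+ 1) ^ 3 ≈[ 1 ] 1α
    α³≈1 = mod-2^ (divides (mkα (+ 0) (+ 1)) refl)

    [1+α]³≈1 : mkα (+ 1) (+ 1) ^ 3 ≈[ 1 ] 1α
    [1+α]³≈1 = mod-2^ (divides (mkα (+ 2) (+ 4)) refl)

opaque
  unfolding _⊗_

  1≉0 : ¬ (1α ≈[ 1 ] 0α)
  1≉0 (mod-2^ d) with ℕD.∣1⇒≡1 (DS.∣⇒∣ᵤ (proj₁ (∣α⇒Dvα d)))
  ... | ()

-- 𝔽₄ˣ has order 3.
zero-or-cube≈1 : ∀ z → z ≈[ 1 ] 0α ⊎ z ^ 3 ≈[ 1 ] 1α
zero-or-cube≈1 (mkα a b) with parity a | parity b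
... | inj₁ (q₁ , refl) | inj₁ (q₂ , refl) = inj₁ (reduce-mod-2 (+ 0) (+ 0) q₁ q₂)
... | inj₂ (q₁ , refl) | inj₁ (q₂ , refl) =
  inj₂ (≈-trans (≈-^ 3 (reduce-mod-2 (+ 1) (+ 0) q₁ q₂)) (≈-reflexive (1^n≡1 3)))
... | inj₁ (q₁ , refl) | inj₂ (q₂ , refl) = inj₂ (≈-trans (≈-^ 3 (reduce-mod-2 (+ 0) (+ 1) q₁ q₂)) α³≈1)
... | inj₂ (q₁ , refl) | inj₂ (q₂ , refl) = inj₂ (≈-trans (≈-^ 3 (reduce-mod-2 (+ 1) (+ 1) q₁ q₂)) [1+α]³≈1)

unit-not≈0 : ∀ {n z w} → z ⊗ w ≈[ suc n ] 1α → ¬ (z ≈[ 1 ] 0α)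
unit-not≈0 {z = z} {w} zw≈1 z≈0 = 1≉0 (begin
  1α        ≈⟨ ≈-sym (≈-weaken (s≤s z≤n) zw≈1) ⟩
  z ⊗ w     ≈⟨ ≈-* z≈0 ≈-refl ⟩
  0α ⊗ w    ≡⟨ ⊗-zeroˡ w ⟩
  0α        ∎)
  where open ≈-Reasoning 1

unit⇒cube≈1 : ∀ {n z w} → z ⊗ w ≈[ suc n ] 1α → z ^ 3 ≈[ 1 ] 1α
unit⇒cube≈1 {z = z} zw≈1 with zero-or-cube≈1 z
... | inj₁ z≈0 = ⊥-elim (unit-not≈0 zw≈1 z≈0)
... | inj₂ z³≈1 = z³≈1

^[1+3q]≈ : ∀ c q → c ^ suc (3 * q) ≈[ 1 ] c
^[1+3q]≈ c q with zero-or-cube≈1 c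
... | inj₁ c≈0 = begin
  c ^ suc (3 * q)    ≈⟨ ≈-^ (suc (3 * q)) c≈0 ⟩
  0α ^ suc (3 * q)   ≡⟨ 0^n≡0 (suc (3 * q)) ⟩
  0α                 ≈⟨ ≈-sym c≈0 ⟩
  c                  ∎
  where open ≈-Reasoning 1
... | inj₂ c³≈1 = go q
  where
  go : ∀ q → c ^ suc (3 * q) ≈[ 1 ] c
  go zero = ≈-reflexive (⊗-identityʳ c)
  go (suc q) = begin
    c ^ suc (3 * suc q)          ≡⟨ cong (c ^_) (cong suc (ℕP.*-suc 3 q)) ⟩
    c ^ (3 ℕ.+ suc (3 * q))      ≡⟨ ^-homo-* c 3 (suc (3 * q)) ⟩
    c ^ 3 ⊗ c ^ suc (3 * q)      ≈⟨ ≈-* c³≈1 (go q) ⟩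
    1α ⊗ c                       ≡⟨ ⊗-identityˡ c ⟩
    c                            ∎
    where open ≈-Reasoning 1

-- Modulo 2, u² is the inverse of u, so the sum is 2x.
x+u[xu²]≈0 : ∀ {u} x → u ^ 3 ≈[ 1 ] 1α → x ⊕ u ⊗ (x ⊗ u ⊗ u) ≈[ 1 ] 0α
x+u[xu²]≈0 {u} x u³≈1 = begin
  x ⊕ u ⊗ (x ⊗ u ⊗ u)   ≡⟨ solve 2 (λ x u → x :+ u :* (x :* u :* u) := x :+ x :* (u :* (u :* (u :* con (+ 1)))))
                                   refl x u ⟩
  x ⊕ x ⊗ u ^ 3         ≈⟨ ≈-+ ≈-refl (≈-*ˡ x u³≈1) ⟩
  x ⊕ x ⊗ 1α            ≡⟨ solve 1 (λ x → x :+ x :* con (+ 1) := con (+ 2) :* x) refl x ⟩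
  two ⊗ x               ≈⟨ ∣α⇒≈0 (2^∣α-multiple 1 x) ⟩
  0α                    ∎
  where open ≈-Reasoning 1

private
  square-of-1+3t : ∀ t → (1 ℕ.+ t * 3) * (1 ℕ.+ t * 3) ≡ suc (3 * (2 * t ℕ.+ 3 * (t * t)))
  square-of-1+3t = ℕ-solve-∀

  square-of-2+3t : ∀ t → (2 ℕ.+ t * 3) * (2 ℕ.+ t * 3) ≡ suc (3 * (1 ℕ.+ 4 * t ℕ.+ 3 * (t * t)))
  square-of-2+3t = ℕ-solve-∀

odd⇒suc-double : ∀ m → ¬ (2 ∣ m) → Σ ℕ λ b → m ≡ suc (2 * b)
odd⇒suc-double m 2∤m with m % 2 | m%n<n m 2 | m≡m%n+[m/n]*n m 2
... | 0 | _ | m≡ = ⊥-elim (2∤m (ℕD.divides (m / 2) m≡))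
... | 1 | _ | m≡ = m / 2 , trans m≡ (cong suc (ℕP.*-comm (m / 2) 2))
... | suc (suc _) | s≤s (s≤s ()) | _

square-mod-3 : ∀ d → ¬ (3 ∣ d) → Σ ℕ λ q → d * d ≡ suc (3 * q)
square-mod-3 d 3∤d with d % 3 | m%n<n d 3 | m≡m%n+[m/n]*n d 3
... | 0 | _ | d≡ = ⊥-elim (3∤d (ℕD.divides (d / 3) d≡))
... | 1 | _ | d≡ = 2 * (d / 3) ℕ.+ 3 * (d / 3 * (d / 3))
                 , trans (cong (λ x → x * x) d≡) (square-of-1+3t (d / 3))
... | 2 | _ | d≡ = 1 ℕ.+ 4 * (d / 3) ℕ.+ 3 * (d / 3 * (d / 3))
                 , trans (cong (λ x → x * x) d≡) (square-of-2+3t (d / 3))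
... | suc (suc (suc _)) | s≤s (s≤s (s≤s ())) | _

fromℕ-suc : ∀ n → fromℕ (suc n) ≡ fromℕ n ⊕ 1α
fromℕ-suc n = trans (cong fromℤ (trans (cong +_ (ℕP.+-comm 1 n)) (sym (ℤP.pos-+ n 1)))) (fromℤ-+ (+ n) (+ 1))

fromℕ-2* : ∀ n → fromℕ (2 * n) ≡ two ⊗ fromℕ n
fromℕ-2* n = trans (cong fromℤ (ℤP.pos-* 2 n)) (fromℤ-* (+ 2) (+ n))

h²≈0 : ∀ {k h} → 2^ k ∣α h → h ⊗ h ≈[ k ℕ.+ k ] 0α
h²≈0 {k} {h} (divides t refl) = ∣α⇒≈0 (∣α-resp-≡ (begin
  2^ (k ℕ.+ k) ⊗ (t ⊗ t)        ≡⟨ cong (_⊗ (t ⊗ t)) (2^-+ k k) ⟩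
  2^ k ⊗ 2^ k ⊗ (t ⊗ t)         ≡⟨ solve 2 (λ p t → p :* p :* (t :* t) := p :* t :* (p :* t)) refl (2^ k) t ⟩
  2^ k ⊗ t ⊗ (2^ k ⊗ t)         ∎) (2^∣α-multiple (k ℕ.+ k) (t ⊗ t)))
  where open ≡-Reasoning

binomial-mod : ∀ {k h} y n → 2^ k ∣α h → (y ⊕ h) ^ suc n ≈[ k ℕ.+ k ] y ^ suc n ⊕ fromℕ (suc n) ⊗ y ^ n ⊗ h
binomial-mod {h = h} y zero _ = ≈-reflexive
  (solve 2 (λ y h → (y :+ h) :* con (+ 1) := y :* con (+ 1) :+ con (+ 1) :* con (+ 1) :* h) refl y h)
binomial-mod {k} {h} y (suc n) 2^k∣h = begin
  (y ⊕ h) ⊗ (y ⊕ h) ^ suc n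
    ≈⟨ ≈-*ˡ (y ⊕ h) (binomial-mod y n 2^k∣h) ⟩
  (y ⊕ h) ⊗ (y ^ suc n ⊕ c ⊗ y ^ n ⊗ h)
    ≡⟨ solve 4 (λ y h yⁿ c → (y :+ h) :* (y :* yⁿ :+ c :* yⁿ :* h)
                            := y :* (y :* yⁿ) :+ (c :+ con (+ 1)) :* (y :* yⁿ) :* h :+ c :* yⁿ :* (h :* h))
               refl y h (y ^ n) c ⟩
  y ^ suc (suc n) ⊕ (c ⊕ 1α) ⊗ y ^ suc n ⊗ h ⊕ c ⊗ y ^ n ⊗ (h ⊗ h)
    ≈⟨ ≈-+ ≈-refl (≈-*ˡ (c ⊗ y ^ n) (h²≈0 2^k∣h)) ⟩
  y ^ suc (suc n) ⊕ (c ⊕ 1α) ⊗ y ^ suc n ⊗ h ⊕ c ⊗ y ^ n ⊗ 0α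
    ≡⟨ solve 4 (λ a b c e → a :+ b :+ c :* e :* con (+ 0) := a :+ b) refl
               (y ^ suc (suc n)) ((c ⊕ 1α) ⊗ y ^ suc n ⊗ h) c (y ^ n) ⟩
  y ^ suc (suc n) ⊕ (c ⊕ 1α) ⊗ y ^ suc n ⊗ h
    ≡⟨ cong (λ c → y ^ suc (suc n) ⊕ c ⊗ y ^ suc n ⊗ h) (sym (fromℕ-suc (suc n))) ⟩
  y ^ suc (suc n) ⊕ fromℕ (suc (suc n)) ⊗ y ^ suc n ⊗ h     ∎
  where
  c = fromℕ (suc n)
  open ≈-Reasoning (k ℕ.+ k)

-- Roots of y ↦ U yᵈ + c with d = 2m, m odd: the derivative d U yᵈ⁻¹ has valuation exactly 1,
-- so a root modulo 8 lifts to a 2-adic root.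
module HenselLifting (m : ℕ) (2∤m : ¬ 2 ∣ m) (U : O) (U-unit : IsUnitO U) (c : ℕ → ℤα) (c-coh : Coherent c) where

  d d-1 : ℕ
  d = 2 * m
  d-1 = ℕ.pred d

  private
    b = proj₁ (odd⇒suc-double m 2∤m)
    m≡1+2b = proj₂ (odd⇒suc-double m 2∤m)

  d≡suc[d-1] : d ≡ suc d-1
  d≡suc[d-1] = subst (λ m → 2 * m ≡ suc (ℕ.pred (2 * m))) (sym m≡1+2b) refl

  F : ℕ → ℤα → ℤα
  F n y = seq U n ⊗ y ^ d ⊕ c n

  F-coherent : ∀ k n y → F (k ℕ.+ n) y ≈[ n ] F n y
  F-coherent k n y = ≈-+ (≈-* (coherent-+ (seq-coherent U) k n) ≈-refl) (coherent-+ c-coh k n)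

  record Approximation (k : ℕ) : Set where
    field
      root : ℤα
      root≈1 : root ≈[ 1 ] 1α
      F[root]≈0 : F (3 ℕ.+ k) root ≈[ 3 ℕ.+ k ] 0α
  open Approximation

  m≈1 : fromℕ m ≈[ 1 ] 1α
  m≈1 = subst (λ m → fromℕ m ≈[ 1 ] 1α) (sym m≡1+2b) (mod-2^ (divides (fromℕ b) (begin
    fromℕ (suc (2 * b)) ⊖ 1α    ≡⟨ cong (_⊖ 1α) (trans (fromℕ-suc (2 * b)) (cong (_⊕ 1α) (fromℕ-2* b))) ⟩
    two ⊗ fromℕ b ⊕ 1α ⊖ 1α     ≡⟨ solve 1 (λ x → con (+ 2) :* x :+ con (+ 1) :- con (+ 1) := con (+ 2) :* x)
                                         refl (fromℕ b) ⟩
    two ⊗ fromℕ b               ∎)))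
    where open ≡-Reasoning

  taylor : ∀ {k h} y → 2^ k ∣α h → (y ⊕ h) ^ d ≈[ k ℕ.+ k ] y ^ d ⊕ fromℕ d ⊗ y ^ d-1 ⊗ h
  taylor {k} {h} y 2^k∣h = subst (λ e → (y ⊕ h) ^ e ≈[ k ℕ.+ k ] y ^ e ⊕ fromℕ e ⊗ y ^ d-1 ⊗ h)
                                 (sym d≡suc[d-1]) (binomial-mod y d-1 2^k∣h)

  -- Newton's step y ↦ y + 2^(k+2) g w², where F y = 2^(k+3) g and w = U y^(d-1) ≡ w⁻² (mod 2).
  refine : ∀ {k} (a : Approximation k) → Σ (Approximation (suc k)) λ a' → root a' ≈[ 2 ℕ.+ k ] root a
  refine {k} a = record { root = y' ; root≈1 = ≈-trans (≈-weaken (s≤s z≤n) y'≈y) (root≈1 a) ; F[root]≈0 = F[y']≈0 }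
               , y'≈y
    where
    n = 3 ℕ.+ k
    y = root a
    U' = seq U (suc n)
    g = 2^_∣α_.quotient (≈0⇒∣α (≈-trans (F-coherent 1 n y) (F[root]≈0 a)))
    F[y]≡ : F (suc n) y ≡ 2^ n ⊗ g
    F[y]≡ = 2^_∣α_.equality (≈0⇒∣α (≈-trans (F-coherent 1 n y) (F[root]≈0 a)))
    w = U' ⊗ y ^ d-1
    t = g ⊗ w ⊗ w
    h = 2^ (2 ℕ.+ k) ⊗ t
    y' = y ⊕ h

    y'≈y : y' ≈[ 2 ℕ.+ k ] y
    y'≈y = mod-2^ (divides t (solve 2 (λ y h → (y :+ h) :- y := h) refl y h))

    w³≈1 : w ^ 3 ≈[ 1 ] 1α
    w³≈1 = unit⇒cube≈1 {n = 0} {w = W} (begin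
      U' ⊗ y ^ d-1 ⊗ W     ≈⟨ ≈-* (≈-*ˡ U' (≈-^ d-1 (root≈1 a))) ≈-refl ⟩
      U' ⊗ 1α ^ d-1 ⊗ W    ≡⟨ cong (λ e → U' ⊗ e ⊗ W) (1^n≡1 d-1) ⟩
      U' ⊗ 1α ⊗ W          ≡⟨ cong (_⊗ W) (⊗-identityʳ U') ⟩
      U' ⊗ W               ≈⟨ ≈-weaken (s≤s z≤n) (inverse-mod-2^ U U-unit (suc n)) ⟩
      1α                   ∎)
      where
      W = seq (proj₁ U-unit) (suc n)
      open ≈-Reasoning 1

    g+mwt≈0 : g ⊕ fromℕ m ⊗ w ⊗ t ≈[ 1 ] 0α
    g+mwt≈0 = begin
      g ⊕ fromℕ m ⊗ w ⊗ t       ≈⟨ ≈-+ ≈-refl (≈-* (≈-* m≈1 ≈-refl) ≈-refl) ⟩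
      g ⊕ 1α ⊗ w ⊗ t            ≡⟨ cong (λ e → g ⊕ e ⊗ t) (⊗-identityˡ w) ⟩
      g ⊕ w ⊗ (g ⊗ w ⊗ w)       ≈⟨ x+u[xu²]≈0 g w³≈1 ⟩
      0α                        ∎
      where open ≈-Reasoning 1

    F[y']≈0 : F (suc n) y' ≈[ suc n ] 0α
    F[y']≈0 = begin
      U' ⊗ (y ⊕ h) ^ d ⊕ c (suc n)
        ≈⟨ ≈-+ (≈-*ˡ U' (≈-weaken (s≤s (s≤s (ℕP.m≤n+m (2 ℕ.+ k) k)))
                                   (taylor y (2^∣α-multiple (2 ℕ.+ k) t)))) ≈-refl ⟩
      U' ⊗ (y ^ d ⊕ fromℕ d ⊗ y ^ d-1 ⊗ h) ⊕ c (suc n)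
        ≡⟨ solve 5 (λ u yᵈ e h c → u :* (yᵈ :+ e :* h) :+ c := (u :* yᵈ :+ c) :+ u :* e :* h)
                   refl U' (y ^ d) (fromℕ d ⊗ y ^ d-1) h (c (suc n)) ⟩
      F (suc n) y ⊕ U' ⊗ (fromℕ d ⊗ y ^ d-1) ⊗ h
        ≡⟨ cong₂ (λ e f → e ⊕ U' ⊗ (f ⊗ y ^ d-1) ⊗ (2^ (2 ℕ.+ k) ⊗ t)) F[y]≡ (fromℕ-2* m) ⟩
      2^ n ⊗ g ⊕ U' ⊗ (two ⊗ fromℕ m ⊗ y ^ d-1) ⊗ (2^ (2 ℕ.+ k) ⊗ t)
        ≡⟨ cong (λ e → e ⊗ g ⊕ U' ⊗ (two ⊗ fromℕ m ⊗ y ^ d-1) ⊗ (2^ (2 ℕ.+ k) ⊗ t)) (2^-suc (2 ℕ.+ k)) ⟩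
      two ⊗ 2^ (2 ℕ.+ k) ⊗ g ⊕ U' ⊗ (two ⊗ fromℕ m ⊗ y ^ d-1) ⊗ (2^ (2 ℕ.+ k) ⊗ t)
        ≡⟨ solve 7 (λ p g u c yᵉ t two → two :* p :* g :+ u :* (two :* c :* yᵉ) :* (p :* t)
                                        := two :* p :* (g :+ c :* (u :* yᵉ) :* t))
                   refl (2^ (2 ℕ.+ k)) g U' (fromℕ m) (y ^ d-1) t two ⟩
      two ⊗ 2^ (2 ℕ.+ k) ⊗ (g ⊕ fromℕ m ⊗ w ⊗ t)
        ≡⟨ cong (_⊗ (g ⊕ fromℕ m ⊗ w ⊗ t)) (sym (2^-suc (2 ℕ.+ k))) ⟩
      2^ n ⊗ (g ⊕ fromℕ m ⊗ w ⊗ t)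
        ≈⟨ ∣α⇒≈0 (subst (λ e → 2^ e ∣α 2^ n ⊗ (g ⊕ fromℕ m ⊗ w ⊗ t)) (ℕP.+-comm n 1)
                        (∣α-scale n (≈0⇒∣α g+mwt≈0))) ⟩
      0α ∎
      where open ≈-Reasoning (suc n)

  hensel : F 3 1α ≈[ 3 ] 0α → Σ O λ Y → (∀ N → seq Y N ≈[ 1 ] 1α) × (∀ N → F N (seq Y N) ≈[ N ] 0α)
  hensel F[1]≈0 = limit a₀ , (λ N → root≈1 (iterate a₀ N)) , F[Y]≈0
    where
    open Limit root (λ a → proj₁ (refine a) , ≈-weaken (ℕP.m≤n+m _ 2) (proj₂ (refine a)))
    a₀ : Approximation 0
    a₀ = record { root = 1α ; root≈1 = ≈-refl ; F[root]≈0 = F[1]≈0 }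
    F[Y]≈0 : ∀ N → F N (seq (limit a₀) N) ≈[ N ] 0α
    F[Y]≈0 N = ≈-trans (≈-sym (F-coherent 3 N (root (iterate a₀ N))))
                       (≈-weaken (ℕP.m≤n+m N 3) (F[root]≈0 (iterate a₀ N)))

levelOffset : Fin 4 → ℕ
levelOffset 0F = 0
levelOffset 1F = 0
levelOffset 2F = 1
levelOffset 3F = 2

diagonalForm : ∀ {n} → ℕ → (Fin n → ℕ) → (u y : Fin n → O) → ℕ → ℤα
diagonalForm {n} d δ u y N = ∑[ e < n ] (2^ (δ e) ⊗ seq (u e) N ⊗ seq (y e) N ^ d)

module SolutionModEight (d q : ℕ) (d²≡1+3q : d * d ≡ suc (3 * q)) where

  -- Since 3 ∤ d, the d-th power map permutes 𝔽₄.
  dth-power-mod-2 : ∀ x → (x ^ d) ^ d ≈[ 1 ] x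
  dth-power-mod-2 x = begin
    (x ^ d) ^ d         ≡⟨ ^-assocʳ x d d ⟩
    x ^ (d * d)         ≡⟨ cong (x ^_) d²≡1+3q ⟩
    x ^ suc (3 * q)     ≈⟨ ^[1+3q]≈ x q ⟩
    x                   ∎
    where open ≈-Reasoning 1

  balance : ℤα → ℤα → ℤα
  balance x u = (x ⊗ u ⊗ u) ^ d

  balance-spec : ∀ {u} x → u ^ 3 ≈[ 1 ] 1α → 2^ 1 ∣α x ⊕ u ⊗ balance x u ^ d
  balance-spec {u} x u³≈1 = ≈0⇒∣α (≈-trans (≈-+ ≈-refl (≈-*ˡ u (dth-power-mod-2 (x ⊗ u ⊗ u)))) (x+u[xu²]≈0 x u³≈1))

  -- Clearing the 2-adic digits one at a time: u₀ + u₁y₁ᵈ = 2z₁, z₁ + u₂y₂ᵈ = 2z₂, z₂ + u₃y₃ᵈ ≡ 0.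
  solution-mod-8 : (u : Fin 4 → ℤα) → (∀ e → u e ^ 3 ≈[ 1 ] 1α) →
    Σ (Fin 4 → ℤα) λ y → y 0F ≡ 1α × ∑[ e < 4 ] (2^ (levelOffset e) ⊗ u e ⊗ y e ^ d) ≈[ 3 ] 0α
  solution-mod-8 u u³≈1 = y , refl , ∣α⇒≈0 (∣α-resp-≡ (sym sum≡) (∣α-scale 2 (balance-spec z₂ (u³≈1 3F))))
    where
    y₁ = balance (u 0F) (u 1F)
    z₁ = 2^_∣α_.quotient (balance-spec (u 0F) (u³≈1 1F))
    y₂ = balance z₁ (u 2F)
    z₂ = 2^_∣α_.quotient (balance-spec z₁ (u³≈1 2F))
    y₃ = balance z₂ (u 3F)

    y : Fin 4 → ℤα
    y 0F = 1α
    y 1F = y₁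
    y 2F = y₂
    y 3F = y₃

    sum≡ : ∑[ e < 4 ] (2^ (levelOffset e) ⊗ u e ⊗ y e ^ d) ≡ 2^ 2 ⊗ (z₂ ⊕ u 3F ⊗ y₃ ^ d)
    sum≡ = begin
      1α ⊗ u 0F ⊗ 1α ^ d ⊕ rest
        ≡⟨ cong (λ e → 1α ⊗ u 0F ⊗ e ⊕ rest) (1^n≡1 d) ⟩
      1α ⊗ u 0F ⊗ 1α ⊕ (1α ⊗ u 1F ⊗ y₁ ^ d ⊕ (two ⊗ u 2F ⊗ y₂ ^ d ⊕ (2^ 2 ⊗ u 3F ⊗ y₃ ^ d ⊕ 0α)))
        ≡⟨ solve 7 (λ u₀ u₁ u₂ u₃ y₁ y₂ y₃ →
                     con (+ 1) :* u₀ :* con (+ 1) :+ (con (+ 1) :* u₁ :* y₁ :+ (con (+ 2) :* u₂ :* y₂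
                       :+ (con (+ 4) :* u₃ :* y₃ :+ con (+ 0))))
                     := (u₀ :+ u₁ :* y₁) :+ con (+ 2) :* u₂ :* y₂ :+ con (+ 4) :* u₃ :* y₃)
                   refl (u 0F) (u 1F) (u 2F) (u 3F) (y₁ ^ d) (y₂ ^ d) (y₃ ^ d) ⟩
      (u 0F ⊕ u 1F ⊗ y₁ ^ d) ⊕ two ⊗ u 2F ⊗ y₂ ^ d ⊕ 2^ 2 ⊗ u 3F ⊗ y₃ ^ d
        ≡⟨ cong (λ e → e ⊕ two ⊗ u 2F ⊗ y₂ ^ d ⊕ 2^ 2 ⊗ u 3F ⊗ y₃ ^ d)
                (2^_∣α_.equality (balance-spec (u 0F) (u³≈1 1F))) ⟩
      two ⊗ z₁ ⊕ two ⊗ u 2F ⊗ y₂ ^ d ⊕ 2^ 2 ⊗ u 3F ⊗ y₃ ^ d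
        ≡⟨ solve 5 (λ z₁ u₂ y₂ u₃ y₃ → con (+ 2) :* z₁ :+ con (+ 2) :* u₂ :* y₂ :+ con (+ 4) :* u₃ :* y₃
                                        := con (+ 4) :* u₃ :* y₃ :+ con (+ 2) :* (z₁ :+ u₂ :* y₂))
                   refl z₁ (u 2F) (y₂ ^ d) (u 3F) (y₃ ^ d) ⟩
      2^ 2 ⊗ u 3F ⊗ y₃ ^ d ⊕ two ⊗ (z₁ ⊕ u 2F ⊗ y₂ ^ d)
        ≡⟨ cong (λ e → 2^ 2 ⊗ u 3F ⊗ y₃ ^ d ⊕ two ⊗ e) (2^_∣α_.equality (balance-spec z₁ (u³≈1 2F))) ⟩
      2^ 2 ⊗ u 3F ⊗ y₃ ^ d ⊕ two ⊗ (two ⊗ z₂)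
        ≡⟨ solve 3 (λ z₂ u₃ y₃ → con (+ 4) :* u₃ :* y₃ :+ con (+ 2) :* (con (+ 2) :* z₂)
                                  := con (+ 4) :* (z₂ :+ u₃ :* y₃))
                   refl z₂ (u 3F) (y₃ ^ d) ⟩
      2^ 2 ⊗ (z₂ ⊕ u 3F ⊗ y₃ ^ d)     ∎
      where
      rest = 1α ⊗ u 1F ⊗ y₁ ^ d ⊕ (two ⊗ u 2F ⊗ y₂ ^ d ⊕ (2^ 2 ⊗ u 3F ⊗ y₃ ^ d ⊕ 0α))
      open ≡-Reasoning

-- Solve modulo 8, then lift the first coordinate by Hensel's lemma with the others fixed.
normalised-zero : ∀ m → ¬ (2 ∣ m) → ¬ (3 ∣ 2 * m) → (u : Fin 4 → O) → (∀ e → IsUnitO (u e)) →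
  Σ (Fin 4 → O) λ y → (∀ N → seq (y 0F) N ≈[ 1 ] 1α) × (∀ N → diagonalForm (2 * m) levelOffset u y N ≈[ N ] 0α)
normalised-zero m 2∤m 3∤d u u-unit = y , y₀≈1 , form≈0
  where
  open SolutionModEight (2 * m) (proj₁ (square-mod-3 (2 * m) 3∤d)) (proj₂ (square-mod-3 (2 * m) 3∤d))
  approx = solution-mod-8 (λ e → seq (u e) 3) (λ e → unit⇒cube≈1 (inverse-mod-2^ (u e) (u-unit e) 3))
  ỹ = proj₁ approx

  tail-term : ℕ → Fin 3 → ℤα
  tail-term N e = 2^ (levelOffset (Fin.suc e)) ⊗ seq (u (Fin.suc e)) N ⊗ ỹ (Fin.suc e) ^ (2 * m)

  c : ℕ → ℤα
  c N = sum (tail-term N)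

  c-coherent : Coherent c
  c-coherent N = ∑-≈ {f = tail-term (suc N)} {g = tail-term N}
                     (λ e → ≈-* (≈-*ˡ (2^ (levelOffset (Fin.suc e))) (seq-coherent (u (Fin.suc e)) N)) ≈-refl)

  open HenselLifting m 2∤m (u 0F) (u-unit 0F) c c-coherent

  F[1]≈0 : F 3 1α ≈[ 3 ] 0α
  F[1]≈0 = ≈-trans (≈-reflexive (cong₂ (λ e f → e ⊗ f ^ d ⊕ c 3) (sym (⊗-identityˡ (seq (u 0F) 3)))
                                                                    (sym (proj₁ (proj₂ approx)))))
                   (proj₂ (proj₂ approx))

  lift = hensel F[1]≈0

  y : Fin 4 → O
  y 0F = proj₁ lift
  y (Fin.suc e) = constO (ỹ (Fin.suc e))

  y₀≈1 : ∀ N → seq (y 0F) N ≈[ 1 ] 1α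
  y₀≈1 = proj₁ (proj₂ lift)

  form≈0 : ∀ N → diagonalForm d levelOffset u y N ≈[ N ] 0α
  form≈0 N = ≈-trans (≈-reflexive (cong (λ e → e ⊗ seq (y 0F) N ^ d ⊕ c N) (⊗-identityˡ (seq (u 0F) N))))
                     (proj₂ (proj₂ lift) N)

private
  p*x+0*y≡p*x : ∀ p x y → p ℤ.* x +ℤ + 0 ℤ.* y ≡ p ℤ.* x
  p*x+0*y≡p*x = solve-∀

  p*x+0*y+0*z≡p*x : ∀ p x y z → p ℤ.* x +ℤ + 0 ℤ.* y +ℤ + 0 ℤ.* z ≡ p ℤ.* x
  p*x+0*y+0*z≡p*x = solve-∀

opaque
  unfolding _⊗_

  2^-cancelˡ : ∀ n {x y} → 2^ n ⊗ x ≡ 2^ n ⊗ y → x ≡ y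
  2^-cancelˡ n {mkα a b} {mkα c e} eq = mkα-cong
    (ℤP.*-cancelˡ-≡ (pow2 n) a c {{ℕP.m^n≢0 2 n}}
      (trans (sym (p*x+0*y≡p*x (pow2 n) a b)) (trans (cong re eq) (p*x+0*y≡p*x (pow2 n) c e))))
    (ℤP.*-cancelˡ-≡ (pow2 n) b e {{ℕP.m^n≢0 2 n}}
      (trans (sym (p*x+0*y+0*z≡p*x (pow2 n) b a b))
             (trans (cong im eq) (p*x+0*y+0*z≡p*x (pow2 n) e c e))))

∣α-cancel : ∀ n {z} → 2^ (suc n) ∣α 2^ n ⊗ z → 2^ 1 ∣α z
∣α-cancel n {z} (divides q eq) = divides q (2^-cancelˡ n (begin
  2^ n ⊗ z             ≡⟨ eq ⟩
  2^ (suc n) ⊗ q       ≡⟨ cong (_⊗ q) (2^-suc n) ⟩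
  two ⊗ 2^ n ⊗ q       ≡⟨ solve 3 (λ a b c → a :* b :* c := b :* (a :* c)) refl two (2^ n) q ⟩
  2^ n ⊗ (two ⊗ q)     ∎))
  where open ≡-Reasoning

unit-not-even : ∀ u → IsUnitO u → ∀ n → ¬ (2^ 1 ∣α seq u (suc n))
unit-not-even u u-unit n 2∣u = unit-not≈0 (inverse-mod-2^ u u-unit (suc n)) (∣α⇒≈0 2∣u)

smaller-exponent-impossible : ∀ {E E' u u'} → IsUnitO u → E < E' →
                              ¬ (∀ N → 2^ E ⊗ seq u N ≈[ N ] 2^ E' ⊗ seq u' N)
smaller-exponent-impossible {E} {E'} {u} {u'} u-unit E<E' eq = unit-not-even u u-unit E
  (∣α-cancel E (∣α-resp-≈ (eq (suc E)) (∣α-weaken E<E' (2^∣α-multiple E' (seq u' (suc E))))))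

unit-exponent-unique : ∀ {E E' u u'} → IsUnitO u → IsUnitO u' →
                       (∀ N → 2^ E ⊗ seq u N ≈[ N ] 2^ E' ⊗ seq u' N) → E ≡ E'
unit-exponent-unique {E} {E'} {u} {u'} u-unit u'-unit eq with ℕP.<-cmp E E'
... | tri≈ _ E≡E' _ = E≡E'
... | tri< E<E' _ _ = ⊥-elim (smaller-exponent-impossible {u = u} {u' = u'} u-unit E<E' eq)
... | tri> _ _ E>E' = ⊥-elim (smaller-exponent-impossible {u = u'} {u' = u} u'-unit E>E' (λ N → ≈-sym (eq N)))

-- a = A / 2ᵖ = 2ᵛ u with the denominators cleared: 2^shiftₐ A = 2^shiftᵤ u, shiftᵤ − shiftₐ = p + v.
record ValuationWitness (a : K) (v : ℤ) (u : O) : Set where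
  field
    shiftₐ shiftᵤ : ℕ
    scaled : ∀ N → 2^ shiftₐ ⊗ seq (num a) N ≈[ N ] 2^ shiftᵤ ⊗ seq u N
    shifts : + shiftᵤ ℤ.- + shiftₐ ≡ + den a +ℤ v

valuation-witness : ∀ a {v u} → a ≈K twoPowK v *K ιK u → ValuationWitness a v u
valuation-witness (mkK p A) {+ n} {u} a≈ = record
  { shiftₐ = 0
  ; shiftᵤ = p ℕ.+ n
  ; scaled = λ N → ≈-trans (≈-reflexive (⊗-def (2^ 0) (seq A N))) (≈-trans (Dvα⇒≈ (a≈ N)) (≈-reflexive (begin
      2^ p *α (2^ n *α seq u N)     ≡⟨ cong (2^ p *α_) (sym (⊗-def (2^ n) (seq u N))) ⟩
      2^ p *α (2^ n ⊗ seq u N)      ≡⟨ sym (⊗-def (2^ p) _) ⟩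
      2^ p ⊗ (2^ n ⊗ seq u N)       ≡⟨ sym (⊗-assoc (2^ p) (2^ n) (seq u N)) ⟩
      2^ p ⊗ 2^ n ⊗ seq u N         ≡⟨ cong (_⊗ seq u N) (sym (2^-+ p n)) ⟩
      2^ (p ℕ.+ n) ⊗ seq u N        ∎)))
  ; shifts = trans (ℤP.+-identityʳ _) (ℤP.pos-+ p n) }
  where open ≡-Reasoning
valuation-witness (mkK p A) { -[1+ n ]} {u} a≈ = record
  { shiftₐ = suc n ℕ.+ 0
  ; shiftᵤ = p
  ; scaled = λ N → ≈-trans (≈-reflexive (⊗-def (2^ (suc n ℕ.+ 0)) (seq A N))) (≈-trans (Dvα⇒≈ (a≈ N))
      (≈-reflexive (trans (cong (2^ p *α_) (trans (sym (⊗-def 1α (seq u N))) (⊗-identityˡ (seq u N))))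
                          (sym (⊗-def (2^ p) (seq u N))))))
  ; shifts = cong (λ x → + p ℤ.- + x) (ℕP.+-identityʳ (suc n)) }

private
  v≡[p+v]-p : ∀ p v → v ≡ (p +ℤ v) ℤ.- p
  v≡[p+v]-p = solve-∀

  b-a≡[a'+b]-[a+a'] : ∀ a b a' → b ℤ.- a ≡ (a' +ℤ b) ℤ.- (a +ℤ a')
  b-a≡[a'+b]-[a+a'] = solve-∀

  [a+b']-[a+a']≡b'-a' : ∀ a b' a' → (a +ℤ b') ℤ.- (a +ℤ a') ≡ b' ℤ.- a'
  [a+b']-[a+a']≡b'-a' = solve-∀

  shift-difference : ∀ {a b a' b'} → a' ℕ.+ b ≡ a ℕ.+ b' → + b ℤ.- + a ≡ + b' ℤ.- + a'
  shift-difference {a} {b} {a'} {b'} eq = begin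
    + b ℤ.- + a                        ≡⟨ b-a≡[a'+b]-[a+a'] (+ a) (+ b) (+ a') ⟩
    (+ a' +ℤ + b) ℤ.- (+ a +ℤ + a')    ≡⟨ cong (ℤ._- (+ a +ℤ + a')) (trans (sym (ℤP.pos-+ a' b))
                                                                   (trans (cong +_ eq) (ℤP.pos-+ a b'))) ⟩
    (+ a +ℤ + b') ℤ.- (+ a +ℤ + a')    ≡⟨ [a+b']-[a+a']≡b'-a' (+ a) (+ b') (+ a') ⟩
    + b' ℤ.- + a'                      ∎
    where open ≡-Reasoning

witnesses-compare : ∀ {a v v' u u'} (V : ValuationWitness a v u) (V' : ValuationWitness a v' u') → ∀ N →
  2^ (ValuationWitness.shiftₐ V' ℕ.+ ValuationWitness.shiftᵤ V) ⊗ seq u N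
    ≈[ N ] 2^ (ValuationWitness.shiftₐ V ℕ.+ ValuationWitness.shiftᵤ V') ⊗ seq u' N
witnesses-compare {a} {u = u} {u'} V V' N = begin
  2^ (sa' ℕ.+ su) ⊗ seq u N         ≡⟨ trans (cong (_⊗ seq u N) (2^-+ sa' su)) (⊗-assoc _ _ _) ⟩
  2^ sa' ⊗ (2^ su ⊗ seq u N)        ≈⟨ ≈-*ˡ (2^ sa') (≈-sym (scaled V N)) ⟩
  2^ sa' ⊗ (2^ sa ⊗ A)              ≡⟨ solve 3 (λ x y z → x :* (y :* z) := y :* (x :* z)) refl (2^ sa') (2^ sa) A ⟩
  2^ sa ⊗ (2^ sa' ⊗ A)              ≈⟨ ≈-*ˡ (2^ sa) (scaled V' N) ⟩
  2^ sa ⊗ (2^ su' ⊗ seq u' N)       ≡⟨ trans (sym (⊗-assoc _ _ _)) (cong (_⊗ seq u' N) (sym (2^-+ sa su'))) ⟩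
  2^ (sa ℕ.+ su') ⊗ seq u' N        ∎
  where
  open ≈-Reasoning N
  open ValuationWitness
  A = seq (num a) N
  sa = shiftₐ V
  su = shiftᵤ V
  sa' = shiftₐ V'
  su' = shiftᵤ V'

valuation-unique : ∀ {a v v'} → HasValuation a v → HasValuation a v' → v ≡ v'
valuation-unique {a} {v} {v'} (u , u-unit , a≈) (u' , u'-unit , a≈') = begin
  v                                         ≡⟨ v≡[p+v]-p (+ den a) v ⟩
  (+ den a +ℤ v) ℤ.- + den a                ≡⟨ cong (ℤ._- + den a) (sym (shifts V)) ⟩
  (+ shiftᵤ V ℤ.- + shiftₐ V) ℤ.- + den a   ≡⟨ cong (ℤ._- + den a) (shift-difference {shiftₐ V} {shiftᵤ V}
                                                 {shiftₐ V'} {shiftᵤ V'} same-exponent) ⟩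
  (+ shiftᵤ V' ℤ.- + shiftₐ V') ℤ.- + den a ≡⟨ cong (ℤ._- + den a) (shifts V') ⟩
  (+ den a +ℤ v') ℤ.- + den a               ≡⟨ sym (v≡[p+v]-p (+ den a) v') ⟩
  v'                                        ∎
  where
  open ≡-Reasoning
  open ValuationWitness
  V : ValuationWitness a v u
  V = valuation-witness a a≈
  V' : ValuationWitness a v' u'
  V' = valuation-witness a a≈'
  same-exponent = unit-exponent-unique {u = u} {u'} u-unit u'-unit (witnesses-compare V V')

private
  offset-difference : ∀ v k x y → (v ℤ.- (k +ℤ x)) ℤ.- (v ℤ.- (k +ℤ (x +ℤ y))) ≡ y
  offset-difference = solve-∀

level-gap : ∀ {d a} k δ e → suc e < d → LevelIs d a (k +ℤ + δ) → ¬ LevelIs d a (k +ℤ + (δ ℕ.+ suc e))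
level-gap {d} {a} k δ e e<d (v , val , d∣v-k-δ) (v' , val' , d∣v'-k-δ-e) =
  ℕP.<⇒≱ e<d (ℕD.∣⇒≤ (DS.∣⇒∣ᵤ d∣gap))
  where
  d∣gap : + d DS.∣ + suc e
  d∣gap = subst (+ d DS.∣_)
    (trans (cong (λ z → (v ℤ.- (k +ℤ + δ)) ℤ.- (v ℤ.- (k +ℤ z))) (ℤP.pos-+ δ (suc e)))
           (offset-difference v k (+ δ) (+ suc e)))
    (DS.∣m∣n⇒∣m-n d∣v-k-δ (subst (λ w → + d DS.∣ w ℤ.- (k +ℤ + (δ ℕ.+ suc e)))
                                 (sym (valuation-unique {a} {v} {v'} val val')) d∣v'-k-δ-e))

-- sumK brings its summands to the common denominator 2^(den of the sum), multiplying g t by 2^(weight t).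
weight : (s : ℕ) → (Fin s → K) → Fin s → ℕ
weight (suc s) g Fin.zero = den (sumK s (λ t → g (Fin.suc t)))
weight (suc s) g (Fin.suc t) = den (g Fin.zero) ℕ.+ weight s (λ t → g (Fin.suc t)) t

weight-+-den : ∀ s (g : Fin s → K) t → weight s g t ℕ.+ den (g t) ≡ den (sumK s g)
weight-+-den (suc s) g Fin.zero = ℕP.+-comm (den (sumK s (λ t → g (Fin.suc t)))) (den (g Fin.zero))
weight-+-den (suc s) g (Fin.suc t) =
  trans (ℕP.+-assoc (den (g Fin.zero)) _ _) (cong (den (g Fin.zero) ℕ.+_) (weight-+-den s (λ t → g (Fin.suc t)) t))

sumK-numerator : ∀ s (g : Fin s → K) N →
                 seq (num (sumK s g)) N ≡ ∑[ t < s ] (2^ (weight s g t) ⊗ seq (num (g t)) N)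
sumK-numerator zero g N = refl
sumK-numerator (suc s) g N = begin
  2^ l *α x +α 2^ k *α seq (num (sumK s g')) N
    ≡⟨ sym (trans (⊕-def _ _) (cong₂ _+α_ (⊗-def _ _) (⊗-def _ _))) ⟩
  2^ l ⊗ x ⊕ 2^ k ⊗ seq (num (sumK s g')) N
    ≡⟨ cong (λ e → 2^ l ⊗ x ⊕ 2^ k ⊗ e) (sumK-numerator s g' N) ⟩
  2^ l ⊗ x ⊕ 2^ k ⊗ ∑[ t < s ] (2^ (weight s g' t) ⊗ seq (num (g' t)) N)
    ≡⟨ cong (2^ l ⊗ x ⊕_) (*-distribˡ-sum (2^ k) (λ t → 2^ (weight s g' t) ⊗ seq (num (g' t)) N)) ⟩
  2^ l ⊗ x ⊕ ∑[ t < s ] (2^ k ⊗ (2^ (weight s g' t) ⊗ seq (num (g' t)) N))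
    ≡⟨ cong (2^ l ⊗ x ⊕_) (sum-cong-≗ (λ t → trans (sym (⊗-assoc _ _ _))
                                          (cong (_⊗ seq (num (g' t)) N) (sym (2^-+ k (weight s g' t)))))) ⟩
  2^ l ⊗ x ⊕ ∑[ t < s ] (2^ (k ℕ.+ weight s g' t) ⊗ seq (num (g' t)) N)   ∎
  where
  open ≡-Reasoning
  g' = λ t → g (Fin.suc t)
  l = den (sumK s g')
  k = den (g Fin.zero)
  x = seq (num (g Fin.zero)) N

num-^K : ∀ x e N → seq (num (x ^K e)) N ≡ seq (num x) N ^ e
num-^K x zero N = refl
num-^K x (suc e) N = trans (sym (⊗-def _ _)) (cong (seq (num x) N ⊗_) (num-^K x e N))

den-^K : ∀ x e → den x ≡ 0 → den (x ^K e) ≡ 0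
den-^K x zero _ = refl
den-^K x (suc e) den≡0 = cong₂ ℕ._+_ den≡0 (den-^K x e den≡0)

zero-criterion : ∀ x → (∀ N → 2^ N ∣α seq (num x) N) → x ≈K 0K
zero-criterion (mkK e X) 2ᴺ∣X N = ≈⇒Dvα (begin
  1α *α seq X N      ≡⟨ trans (sym (⊗-def 1α (seq X N))) (⊗-identityˡ (seq X N)) ⟩
  seq X N            ≈⟨ ∣α⇒≈0 (2ᴺ∣X N) ⟩
  0α                 ≡⟨ trans (sym (⊗-zeroʳ (2^ e))) (⊗-def (2^ e) 0α) ⟩
  2^ e *α 0α         ∎)
  where open ≈-Reasoning N

nonzero-criterion : ∀ f (Y : O) → (∀ N → seq Y N ≈[ 1 ] 1α) → ¬ (mkK 0 (twoO f *O Y) ≈K 0K)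
nonzero-criterion f Y Y≈1 x≈0 = 1≉0 (begin
  1α            ≈⟨ ≈-sym (Y≈1 (suc f)) ⟩
  seq Y (suc f) ≈⟨ ∣α⇒≈0 (∣α-cancel f (≈0⇒∣α 2^fY≈0)) ⟩
  0α            ∎)
  where
  open ≈-Reasoning 1
  2^fY≈0 : 2^ f ⊗ seq Y (suc f) ≈[ suc f ] 0α
  2^fY≈0 = ≈-trans (≈-reflexive (trans (sym (⊗-identityˡ _)) (trans (⊗-def 1α _) (cong (1α *α_) (⊗-def _ _)))))
             (≈-trans (Dvα⇒≈ (x≈0 (suc f))) (≈-reflexive (trans (sym (⊗-def 1α 0α)) (⊗-identityˡ 0α))))

indicator : ∀ {s} → Fin s → ℤα → Fin s → ℤα
indicator Fin.zero X Fin.zero = X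
indicator Fin.zero X (Fin.suc t) = 0α
indicator (Fin.suc a) X Fin.zero = 0α
indicator (Fin.suc a) X (Fin.suc t) = indicator a X t

indicator-self : ∀ {s} (a : Fin s) X → indicator a X a ≡ X
indicator-self Fin.zero X = refl
indicator-self (Fin.suc a) X = indicator-self a X

indicator-other : ∀ {s} (a t : Fin s) X → t ≢ a → indicator a X t ≡ 0α
indicator-other Fin.zero Fin.zero X t≢a = ⊥-elim (t≢a refl)
indicator-other Fin.zero (Fin.suc t) X _ = refl
indicator-other (Fin.suc a) Fin.zero X _ = refl
indicator-other (Fin.suc a) (Fin.suc t) X t≢a = indicator-other a t X (λ t≡a → t≢a (cong Fin.suc t≡a))

∑-indicator : ∀ {s} (a : Fin s) X → sum (indicator a X) ≡ X
∑-indicator {suc s} Fin.zero X = trans (cong (X ⊕_) (sum-replicate-zero s)) (⊕-identityʳ X)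
∑-indicator {suc s} (Fin.suc a) X = trans (⊕-identityˡ _) (∑-indicator a X)

module _ {n s} (ι : Fin n → Fin s) (ι-injective : ∀ {e e'} → ι e ≡ ι e' → e ≡ e') where

  private
    indicators : (Fin s → ℤα) → Fin s → Fin n → ℤα
    indicators f t e = indicator (ι e) (f (ι e)) t

    indicators-image : ∀ f e → sum (indicators f (ι e)) ≡ f (ι e)
    indicators-image f e = trans (sum-cong-≗ same) (∑-indicator e (f (ι e)))
      where
      same : ∀ e' → indicators f (ι e) e' ≡ indicator e (f (ι e)) e'
      same e' with e' Fin.≟ e
      ... | yes refl = trans (indicator-self (ι e) (f (ι e))) (sym (indicator-self e (f (ι e))))
      ... | no e'≢e = trans (indicator-other (ι e') (ι e) (f (ι e')) (λ ιe≡ιe' → e'≢e (sym (ι-injective ιe≡ιe'))))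
                            (sym (indicator-other e e' (f (ι e)) e'≢e))

  ∑-over-image : ∀ (f : Fin s → ℤα) → (∀ t → (∀ e → t ≢ ι e) → f t ≡ 0α) → sum f ≡ ∑[ e < n ] f (ι e)
  ∑-over-image f f-outside = begin
    sum f                                    ≡⟨ sum-cong-≗ pointwise ⟩
    ∑[ t < s ] sum (indicators f t)          ≡⟨ ∑-comm (λ t e → indicators f t e) ⟩
    ∑[ e < n ] ∑[ t < s ] indicators f t e   ≡⟨ sum-cong-≗ (λ e → ∑-indicator (ι e) (f (ι e))) ⟩
    ∑[ e < n ] f (ι e)                       ∎
    where
    open ≡-Reasoning
    pointwise : ∀ t → f t ≡ sum (indicators f t)
    pointwise t with any? (λ e → t Fin.≟ ι e)
    ... | yes (e , refl) = sym (indicators-image f e)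
    ... | no t∉ι = trans (f-outside t (λ e t≡ιe → t∉ι (e , t≡ιe)))
                         (sym (trans (sum-cong-≗ (λ e → indicator-other (ι e) t (f (ι e)) (λ t≡ιe → t∉ι (e , t≡ιe))))
                                     (sum-replicate-zero n)))

  extend : (Fin n → K) → Fin s → K
  extend X t with any? (λ e → t Fin.≟ ι e)
  ... | yes (e , _) = X e
  ... | no _ = 0K

  extend-image : ∀ X e → extend X (ι e) ≡ X e
  extend-image X e with any? (λ e' → ι e Fin.≟ ι e')
  ... | yes (e' , ιe≡ιe') = cong X (sym (ι-injective ιe≡ιe'))
  ... | no ιe∉ι = ⊥-elim (ιe∉ι (e , refl))

  extend-outside : ∀ X t → (∀ e → t ≢ ι e) → extend X t ≡ 0K
  extend-outside X t t∉ι with any? (λ e → t Fin.≟ ι e)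
  ... | yes (e , t≡ιe) = ⊥-elim (t∉ι e t≡ιe)
  ... | no _ = refl

private
  w+r+b≡w+[r+a]+[b-a] : ∀ w r a b → w +ℤ r +ℤ b ≡ w +ℤ (r +ℤ a) +ℤ (b ℤ.- a)
  w+r+b≡w+[r+a]+[b-a] = solve-∀

  w+fd+[p+v]≡w+p+fd+v : ∀ w p fd v → w +ℤ fd +ℤ (p +ℤ v) ≡ w +ℤ p +ℤ fd +ℤ v
  w+fd+[p+v]≡w+p+fd+v = solve-∀

  exponent-bookkeeping : ∀ {w p fd r a b v E} → r +ℤ a ≡ fd → b ℤ.- a ≡ p +ℤ v →
                         w +ℤ p +ℤ fd +ℤ v ≡ E → w +ℤ r +ℤ b ≡ E
  exponent-bookkeeping {w} {p} {fd} {r} {a} {b} {v} {E} r+a≡fd b-a≡p+v eq = begin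
    w +ℤ r +ℤ b                    ≡⟨ w+r+b≡w+[r+a]+[b-a] w r a b ⟩
    w +ℤ (r +ℤ a) +ℤ (b ℤ.- a)     ≡⟨ cong₂ (λ x y → w +ℤ x +ℤ y) r+a≡fd b-a≡p+v ⟩
    w +ℤ fd +ℤ (p +ℤ v)            ≡⟨ w+fd+[p+v]≡w+p+fd+v w p fd v ⟩
    w +ℤ p +ℤ fd +ℤ v              ≡⟨ eq ⟩
    E                              ∎
    where open ≡-Reasoning

monomial-≈ : ∀ {a v u} (V : ValuationWitness a v u) d f (Y : O) W E →
  ValuationWitness.shiftₐ V ≤ f * d → + W +ℤ + den a +ℤ + (f * d) +ℤ v ≡ + E →
  ∀ N → 2^ W ⊗ seq (num (a *K (mkK 0 (twoO f *O Y) ^K d))) N ≈[ N ] 2^ E ⊗ (seq u N ⊗ seq Y N ^ d)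
monomial-≈ {a} {v} {u} V d f Y W E sa≤fd exponents N = begin
  2^ W ⊗ (A *α seq (num (x ^K d)) N)
    ≡⟨ cong (2^ W ⊗_) (trans (sym (⊗-def A _)) (cong (A ⊗_) (num-^K x d N))) ⟩
  2^ W ⊗ (A ⊗ seq (twoO f *O Y) N ^ d)
    ≡⟨ cong (λ z → 2^ W ⊗ (A ⊗ z ^ d)) (sym (⊗-def (2^ f) y)) ⟩
  2^ W ⊗ (A ⊗ (2^ f ⊗ y) ^ d)
    ≡⟨ cong (λ z → 2^ W ⊗ (A ⊗ z)) (trans (^-distrib-* (2^ f) y d) (cong (_⊗ y ^ d) (2^-^ f d))) ⟩
  2^ W ⊗ (A ⊗ (2^ (f * d) ⊗ y ^ d))
    ≡⟨ cong (λ z → 2^ W ⊗ (A ⊗ (z ⊗ y ^ d))) (trans (cong 2^ (sym r+sa≡fd)) (2^-+ r sa)) ⟩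
  2^ W ⊗ (A ⊗ (2^ r ⊗ 2^ sa ⊗ y ^ d))
    ≡⟨ solve 5 (λ w a r s y → w :* (a :* (r :* s :* y)) := w :* r :* (s :* a :* y))
               refl (2^ W) A (2^ r) (2^ sa) (y ^ d) ⟩
  2^ W ⊗ 2^ r ⊗ (2^ sa ⊗ A ⊗ y ^ d)
    ≈⟨ ≈-*ˡ (2^ W ⊗ 2^ r) (≈-* (scaled N) ≈-refl) ⟩
  2^ W ⊗ 2^ r ⊗ (2^ su ⊗ seq u N ⊗ y ^ d)
    ≡⟨ solve 5 (λ w r s u y → w :* r :* (s :* u :* y) := w :* r :* s :* (u :* y))
               refl (2^ W) (2^ r) (2^ su) (seq u N) (y ^ d) ⟩
  2^ W ⊗ 2^ r ⊗ 2^ su ⊗ (seq u N ⊗ y ^ d)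
    ≡⟨ cong (_⊗ (seq u N ⊗ y ^ d)) (trans (sym (cong (_⊗ 2^ su) (2^-+ W r))) (sym (2^-+ (W ℕ.+ r) su))) ⟩
  2^ (W ℕ.+ r ℕ.+ su) ⊗ (seq u N ⊗ y ^ d)
    ≡⟨ cong (λ e → 2^ e ⊗ (seq u N ⊗ y ^ d)) W+r+su≡E ⟩
  2^ E ⊗ (seq u N ⊗ y ^ d)       ∎
  where
  open ≈-Reasoning N
  open ValuationWitness V
  x = mkK 0 (twoO f *O Y)
  A = seq (num a) N
  y = seq Y N
  sa = shiftₐ
  su = shiftᵤ
  r = f * d ℕ.∸ sa
  r+sa≡fd : r ℕ.+ sa ≡ f * d
  r+sa≡fd = ℕP.m∸n+n≡m sa≤fd
  W+r+su≡E : W ℕ.+ r ℕ.+ su ≡ E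
  W+r+su≡E = ℤP.+-injective (trans (trans (ℤP.pos-+ (W ℕ.+ r) su) (cong (_+ℤ + su) (ℤP.pos-+ W r)))
    (exponent-bookkeeping {+ W} {+ den a} {+ (f * d)} {+ r} {+ sa} {+ su} {v} {+ E}
                          (trans (sym (ℤP.pos-+ r sa)) (cong +_ r+sa≡fd)) shifts exponents))

NontrivialZero : (s : ℕ) → (Fin s → K) → ℕ → Set
NontrivialZero s a d =
  Σ (Fin s → K) λ x → (Σ (Fin s) λ t → ¬ (x t ≈K 0K)) × (sumK s (λ t → a t *K (x t ^K d)) ≈K 0K)

upper-bound : ∀ {n} (h : Fin n → ℕ) → Σ ℕ λ M → ∀ e → h e ≤ M
upper-bound {zero} h = 0 , λ ()
upper-bound {suc n} h with upper-bound (λ e → h (Fin.suc e))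
... | M , h≤M = h Fin.zero ℕ.⊔ M , λ { Fin.zero → ℕP.m≤m⊔n _ M
                                    ; (Fin.suc e) → ℕP.≤-trans (h≤M e) (ℕP.m≤n⊔m (h Fin.zero) M) }

bounded-difference : ∀ M α c → ℤ.∣ c ∣ ℕ.+ α ≤ M → Σ ℕ λ f → + f ≡ + M ℤ.- c × α ≤ f
bounded-difference M α (+ n) le = M ℕ.∸ n
  , sym (trans (ℤP.m-n≡m⊖n M n) (ℤP.⊖-≥ (ℕP.≤-trans (ℕP.m≤m+n n α) le)))
  , ℕP.≤-trans (ℕP.≤-reflexive (sym (ℕP.m+n∸m≡n n α))) (ℕP.∸-monoˡ-≤ n le)
bounded-difference M α -[1+ n ] le = M ℕ.+ suc n
  , ℤP.pos-+ M (suc n)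
  , ℕP.≤-trans (ℕP.≤-trans (ℕP.m≤n+m α (suc n)) le) (ℕP.m≤m+n M (suc n))

bounded-sum : ∀ k X → ℤ.∣ k ∣ ≤ X → Σ ℕ λ G → + G ≡ k +ℤ + X
bounded-sum (+ n) X _ = n ℕ.+ X , ℤP.pos-+ n X
bounded-sum -[1+ n ] X le = X ℕ.∸ suc n
  , sym (trans (ℤP.+-comm -[1+ n ] (+ X)) (trans (ℤP.m-n≡m⊖n X (suc n)) (ℤP.⊖-≥ le)))

private
  D+e+v≡D+e+[v-κ]+κ : ∀ D e v κ → D +ℤ e +ℤ v ≡ D +ℤ e +ℤ (v ℤ.- κ) +ℤ κ
  D+e+v≡D+e+[v-κ]+κ = solve-∀

  D+[M-c]d+cd+[k+δ]≡D+[k+dM]+δ : ∀ D M c d k δ →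
                                 D +ℤ (M ℤ.- c) ℤ.* d +ℤ c ℤ.* d +ℤ (k +ℤ δ) ≡ D +ℤ (k +ℤ d ℤ.* M) +ℤ δ
  D+[M-c]d+cd+[k+δ]≡D+[k+dM]+δ = solve-∀

scaling-exponents : ∀ D f d v c k δ M G → + f ≡ + M ℤ.- c → v ℤ.- (k +ℤ + δ) ≡ c ℤ.* + d →
                    + G ≡ k +ℤ + (d * M) → + D +ℤ + (f * d) +ℤ v ≡ + (D ℕ.+ G ℕ.+ δ)
scaling-exponents D f d v c k δ M G f≡ v≡ G≡ = begin
  + D +ℤ + (f * d) +ℤ v
    ≡⟨ cong (λ z → + D +ℤ z +ℤ v) (trans (ℤP.pos-* f d) (cong (ℤ._* + d) f≡)) ⟩
  + D +ℤ (+ M ℤ.- c) ℤ.* + d +ℤ v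
    ≡⟨ D+e+v≡D+e+[v-κ]+κ (+ D) ((+ M ℤ.- c) ℤ.* + d) v (k +ℤ + δ) ⟩
  + D +ℤ (+ M ℤ.- c) ℤ.* + d +ℤ (v ℤ.- (k +ℤ + δ)) +ℤ (k +ℤ + δ)
    ≡⟨ cong (λ z → + D +ℤ (+ M ℤ.- c) ℤ.* + d +ℤ z +ℤ (k +ℤ + δ)) v≡ ⟩
  + D +ℤ (+ M ℤ.- c) ℤ.* + d +ℤ c ℤ.* + d +ℤ (k +ℤ + δ)
    ≡⟨ D+[M-c]d+cd+[k+δ]≡D+[k+dM]+δ (+ D) (+ M) c (+ d) k (+ δ) ⟩
  + D +ℤ (k +ℤ + d ℤ.* + M) +ℤ + δ
    ≡⟨ cong (λ z → + D +ℤ z +ℤ + δ) (trans (cong (k +ℤ_) (sym (ℤP.pos-* d M))) (sym G≡)) ⟩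
  + (D ℕ.+ G ℕ.+ δ)  ∎
  where open ≡-Reasoning

-- x(ι e) = 2^(f e) yₑ with f e chosen so that a(ι e) x(ι e)ᵈ = 2^(G + δ e) uₑ yₑᵈ for a common G.
module Rescaling {n s d} .{{_ : NonZero d}} (a : Fin s → K) (ι : Fin n → Fin s)
                 (ι-injective : ∀ {e e'} → ι e ≡ ι e' → e ≡ e') (δ : Fin n → ℕ) (k : ℤ)
                 (level : ∀ e → LevelIs d (a (ι e)) (k +ℤ + δ e)) where

  v : Fin n → ℤ
  v e = proj₁ (level e)

  u : Fin n → O
  u e = proj₁ (proj₁ (proj₂ (level e)))

  u-unit : ∀ e → IsUnitO (u e)
  u-unit e = proj₁ (proj₂ (proj₁ (proj₂ (level e))))

  scaled-zero : (y : Fin n → O) (e₀ : Fin n) → (∀ N → seq (y e₀) N ≈[ 1 ] 1α) →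
                (∀ N → diagonalForm d δ u y N ≈[ N ] 0α) → NontrivialZero s a d
  scaled-zero y e₀ y₀≈1 form≈0 = x , (ι e₀ , x≉0) , zero-criterion (sumK s g) (λ N → ≈0⇒∣α (sum≈0 N))
    where
    open ValuationWitness using (shiftₐ)

    V : ∀ e → ValuationWitness (a (ι e)) (v e) (u e)
    V e = valuation-witness (a (ι e)) (proj₂ (proj₂ (proj₁ (proj₂ (level e)))))

    c : Fin n → ℤ
    c e = DS._∣_.quotient (proj₂ (proj₂ (level e)))

    M₀ = upper-bound (λ e → ℤ.∣ c e ∣ ℕ.+ shiftₐ (V e))
    M = ℤ.∣ k ∣ ℕ.+ proj₁ M₀

    f-spec : ∀ e → Σ ℕ λ f → + f ≡ + M ℤ.- c e × shiftₐ (V e) ≤ f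
    f-spec e = bounded-difference M (shiftₐ (V e)) (c e) (ℕP.≤-trans (proj₂ M₀ e) (ℕP.m≤n+m _ ℤ.∣ k ∣))

    f : Fin n → ℕ
    f e = proj₁ (f-spec e)

    G-spec = bounded-sum k (d * M) (ℕP.≤-trans (ℕP.m≤m+n ℤ.∣ k ∣ (proj₁ M₀)) (ℕP.m≤n*m M d))
    G = proj₁ G-spec

    x : Fin s → K
    x = extend ι ι-injective (λ e → mkK 0 (twoO (f e) *O y e))

    g : Fin s → K
    g t = a t *K (x t ^K d)

    D = den (sumK s g)

    x≉0 : ¬ (x (ι e₀) ≈K 0K)
    x≉0 = subst (λ z → ¬ (z ≈K 0K)) (sym (extend-image ι ι-injective _ e₀)) (nonzero-criterion (f e₀) (y e₀) y₀≈1)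

    term : ℕ → Fin s → ℤα
    term N t = 2^ (weight s g t) ⊗ seq (num (g t)) N

    term-outside : ∀ N t → (∀ e → t ≢ ι e) → term N t ≡ 0α
    term-outside N t t∉ι = begin
      2^ W ⊗ (A *α seq (num (x t ^K d)) N)
        ≡⟨ cong (λ z → 2^ W ⊗ (A *α seq (num (z ^K d)) N)) (extend-outside ι ι-injective _ t t∉ι) ⟩
      2^ W ⊗ (A *α seq (num (0K ^K d)) N)
        ≡⟨ cong (2^ W ⊗_) (trans (sym (⊗-def _ _)) (cong (A ⊗_) (trans (num-^K 0K d N) (0^n≡0 d)))) ⟩
      2^ W ⊗ (A ⊗ 0α)
        ≡⟨ trans (cong (2^ W ⊗_) (⊗-zeroʳ A)) (⊗-zeroʳ (2^ W)) ⟩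
      0α ∎
      where
      open ≡-Reasoning
      W = weight s g t
      A = seq (num (a t)) N

    term-image : ∀ N e → term N (ι e) ≈[ N ] 2^ (D ℕ.+ G) ⊗ (2^ (δ e) ⊗ seq (u e) N ⊗ seq (y e) N ^ d)
    term-image N e = begin
      2^ W ⊗ seq (num (a (ι e) *K (x (ι e) ^K d))) N
        ≡⟨ cong (λ z → 2^ W ⊗ seq (num (a (ι e) *K (z ^K d))) N) (extend-image ι ι-injective _ e) ⟩
      2^ W ⊗ seq (num (a (ι e) *K (mkK 0 (twoO (f e) *O y e) ^K d))) N
        ≈⟨ monomial-≈ (V e) d (f e) (y e) W (D ℕ.+ G ℕ.+ δ e) sa≤fd exponents N ⟩
      2^ (D ℕ.+ G ℕ.+ δ e) ⊗ (seq (u e) N ⊗ seq (y e) N ^ d)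
        ≡⟨ trans (cong (_⊗ (seq (u e) N ⊗ seq (y e) N ^ d)) (2^-+ (D ℕ.+ G) (δ e)))
                 (solve 4 (λ p q u y → p :* q :* (u :* y) := p :* (q :* u :* y)) refl
                          (2^ (D ℕ.+ G)) (2^ (δ e)) (seq (u e) N) (seq (y e) N ^ d)) ⟩
      2^ (D ℕ.+ G) ⊗ (2^ (δ e) ⊗ seq (u e) N ⊗ seq (y e) N ^ d) ∎
      where
      open ≈-Reasoning N
      W = weight s g (ι e)
      sa≤fd : shiftₐ (V e) ≤ f e * d
      sa≤fd = ℕP.≤-trans (proj₂ (proj₂ (f-spec e))) (ℕP.m≤m*n (f e) d)
      W+p≡D : W ℕ.+ den (a (ι e)) ≡ D
      W+p≡D = trans (cong (W ℕ.+_) (sym (trans (cong (den (a (ι e)) ℕ.+_)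
                      (den-^K (x (ι e)) d (cong den (extend-image ι ι-injective _ e)))) (ℕP.+-identityʳ _))))
                    (weight-+-den s g (ι e))
      exponents : + W +ℤ + den (a (ι e)) +ℤ + (f e * d) +ℤ v e ≡ + (D ℕ.+ G ℕ.+ δ e)
      exponents = trans (cong (λ z → + z +ℤ + (f e * d) +ℤ v e) W+p≡D)
        (scaling-exponents D (f e) d (v e) (c e) k (δ e) M G (proj₁ (proj₂ (f-spec e)))
                           (DS._∣_.equality (proj₂ (proj₂ (level e)))) (proj₂ G-spec))

    sum≈0 : ∀ N → seq (num (sumK s g)) N ≈[ N ] 0α
    sum≈0 N = begin
      seq (num (sumK s g)) N                          ≡⟨ sumK-numerator s g N ⟩
      sum (term N)                                    ≡⟨ ∑-over-image ι ι-injective (term N) (term-outside N) ⟩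
      ∑[ e < n ] term N (ι e)                         ≈⟨ ∑-≈ {f = λ e → term N (ι e)} (term-image N) ⟩
      ∑[ e < n ] (2^ (D ℕ.+ G) ⊗ (2^ (δ e) ⊗ seq (u e) N ⊗ seq (y e) N ^ d))
        ≡⟨ sym (*-distribˡ-sum (2^ (D ℕ.+ G)) (λ e → 2^ (δ e) ⊗ seq (u e) N ⊗ seq (y e) N ^ d)) ⟩
      2^ (D ℕ.+ G) ⊗ diagonalForm d δ u y N           ≈⟨ ≈-*ˡ (2^ (D ℕ.+ G)) (form≈0 N) ⟩
      2^ (D ℕ.+ G) ⊗ 0α                               ≡⟨ ⊗-zeroʳ _ ⟩
      0α                                              ∎
      where open ≈-Reasoning N

module FourVariables {s d} (2<d : 2 < d) (a : Fin s → K) (k : ℤ) (i j l r : Fin s) (i≢j : i ≢ j)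
  (Lᵢ : LevelIs d (a i) k) (Lⱼ : LevelIs d (a j) k)
  (Lₗ : LevelIs d (a l) (k +ℤ + 1)) (Lᵣ : LevelIs d (a r) (k +ℤ + 2)) where

  ι : Fin 4 → Fin s
  ι 0F = i
  ι 1F = j
  ι 2F = l
  ι 3F = r

  level : ∀ e → LevelIs d (a (ι e)) (k +ℤ + levelOffset e)
  level 0F = subst (LevelIs d (a i)) (sym (ℤP.+-identityʳ k)) Lᵢ
  level 1F = subst (LevelIs d (a j)) (sym (ℤP.+-identityʳ k)) Lⱼ
  level 2F = Lₗ
  level 3F = Lᵣ

  separated : ∀ {e e'} gap → gap ≤ 1 → levelOffset e' ≡ levelOffset e ℕ.+ suc gap → ι e ≢ ι e'
  separated {e} {e'} gap gap≤1 offsets ιe≡ιe' =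
    level-gap {d} {a (ι e)} k (levelOffset e) gap (ℕP.≤-<-trans (s≤s gap≤1) 2<d) (level e)
      (subst (λ o → LevelIs d (a (ι e)) (k +ℤ + o)) offsets
             (subst (λ t → LevelIs d (a t) (k +ℤ + levelOffset e')) (sym ιe≡ιe') (level e')))

  ι-injective : ∀ {e e'} → ι e ≡ ι e' → e ≡ e'
  ι-injective {0F} {0F} _ = refl
  ι-injective {1F} {1F} _ = refl
  ι-injective {2F} {2F} _ = refl
  ι-injective {3F} {3F} _ = refl
  ι-injective {0F} {1F} p = ⊥-elim (i≢j p)
  ι-injective {1F} {0F} p = ⊥-elim (i≢j (sym p))
  ι-injective {0F} {2F} p = ⊥-elim (separated 0 z≤n refl p)
  ι-injective {2F} {0F} p = ⊥-elim (separated 0 z≤n refl (sym p))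
  ι-injective {1F} {2F} p = ⊥-elim (separated 0 z≤n refl p)
  ι-injective {2F} {1F} p = ⊥-elim (separated 0 z≤n refl (sym p))
  ι-injective {2F} {3F} p = ⊥-elim (separated 0 z≤n refl p)
  ι-injective {3F} {2F} p = ⊥-elim (separated 0 z≤n refl (sym p))
  ι-injective {0F} {3F} p = ⊥-elim (separated 1 (s≤s z≤n) refl p)
  ι-injective {3F} {0F} p = ⊥-elim (separated 1 (s≤s z≤n) refl (sym p))
  ι-injective {1F} {3F} p = ⊥-elim (separated 1 (s≤s z≤n) refl p)
  ι-injective {3F} {1F} p = ⊥-elim (separated 1 (s≤s z≤n) refl (sym p))

lemma27 : (m : ℕ) → 3 ≤ m → ¬ (2 ∣ m) → ¬ (3 ∣ 2 * m) →
          (s : ℕ) (a : Fin s → K) (k : ℤ) →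
          (i j : Fin s) → i ≢ j →
          LevelIs (2 * m) (a i) k → LevelIs (2 * m) (a j) k →
          (l : Fin s) → LevelIs (2 * m) (a l) (k +ℤ + 1) →
          (r : Fin s) → LevelIs (2 * m) (a r) (k +ℤ + 2) →
          Σ (Fin s → K) λ x →
            (Σ (Fin s) λ t → ¬ (x t ≈K 0K)) ×
            (sumK s (λ t → a t *K (x t ^K (2 * m))) ≈K 0K)
lemma27 m 3≤m 2∤m 3∤d s a k i j i≢j Lᵢ Lⱼ l Lₗ r Lᵣ =
  let (y , y₀≈1 , form≈0) = normalised-zero m 2∤m 3∤d u u-unit in scaled-zero y 0F y₀≈1 form≈0
  where
  2<d : 2 < 2 * m
  2<d = ℕP.≤-trans 3≤m (ℕP.m≤m+n m (m ℕ.+ 0))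

  open FourVariables 2<d a k i j l r i≢j Lᵢ Lⱼ Lₗ Lᵣ
  open Rescaling {d = 2 * m} {{ℕ.>-nonZero (ℕP.<-trans (s≤s z≤n) 2<d)}} a ι ι-injective levelOffset k level
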